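{- Let $G$ be a maximal outerplanar graph of order $n\ge 3$, embedded in the plane as an outerplane graph. Let $A$ be the set of vertices of $G$ that lie on a $4$-cycle of $G'$, and let $B_2$ be the set of vertices of degree $2$ in $G$. Then $|B_2|\ge \frac{1}{2}|A|+2$.
   Context: Graphs are finite and simple. A graph is maximal outerplanar if it has a plane drawing with all vertices on the outer face and adding any edge destroys this property. In such a drawing, the outer edges are those on the cycle bounding the outer face, and the other edges are chords; $G'$ denotes the spanning subgraph of $G$ whose edge set is the set of chords. -}

module Defs where

open import Data.Nat using (ℕ; zero; suc; _+_; _*_; _≤_)
import Data.Nat as ℕ
open import Data.Fin using (Fin; toℕ; _<_; _≟_)
open import Data.Bool using (Bool; true; false; _∧_; _∨_; not; T; if_then_else_)
open import Data.List using (List; allFin; foldr)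
open import Data.Product using (Σ; _×_; _,_)
open import Data.Sum using (_⊎_)
open import Relation.Nullary using (¬_)
open import Relation.Nullary.Decidable using (⌊_⌋)
open import Relation.Binary.PropositionalEquality using (_≡_; _≢_)
open import Function.Definitions using (Injective)

record Graph (n : ℕ) : Set where
  field
    adj    : Fin n → Fin n → Bool
    sym    : ∀ u v → adj u v ≡ adj v u
    irrefl : ∀ v → adj v v ≡ false
open Graph public

-- Vertices placed in convex position on a circle: pos v is the position
-- of v in the cyclic order 0,1,...,n-1 around the circle.
-- c lies strictly inside the arc between positions a and b (one side).
Between : ∀ {n} → Fin n → Fin n → Fin n → Set
Between a b c = (a < c × c < b) ⊎ (b < c × c < a)

Cross : ∀ {n} → (Fin n → Fin n) → Fin n → Fin n → Fin n → Fin n → Set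
Cross pos u v x y =
  (pos x ≢ pos u) × (pos x ≢ pos v) × (pos y ≢ pos u) × (pos y ≢ pos v) ×
  ((Between (pos u) (pos v) (pos x) × ¬ Between (pos u) (pos v) (pos y)) ⊎
   (¬ Between (pos u) (pos v) (pos x) × Between (pos u) (pos v) (pos y)))

NonCrossing : ∀ {n} → (Fin n → Fin n) → (Fin n → Fin n → Bool) → Set
NonCrossing pos a = ∀ u v x y → T (a u v) → T (a x y) → ¬ Cross pos u v x y

-- An outerplane drawing: vertices injectively on a circle, edges as chords, no crossings.

OuterplaneEmbedding : ∀ {n} → (Fin n → Fin n → Bool) → (Fin n → Fin n) → Set
OuterplaneEmbedding a pos = Injective _≡_ _≡_ pos × NonCrossing pos a

IsOuterplanar : ∀ {n} → (Fin n → Fin n → Bool) → Set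
IsOuterplanar {n} a = Σ (Fin n → Fin n) (OuterplaneEmbedding a)

addEdge : ∀ {n} → (Fin n → Fin n → Bool) → Fin n → Fin n → Fin n → Fin n → Bool
addEdge a u v x y = a x y ∨ ((⌊ x ≟ u ⌋ ∧ ⌊ y ≟ v ⌋) ∨ (⌊ x ≟ v ⌋ ∧ ⌊ y ≟ u ⌋))

MaximalOuterplanar : ∀ {n} → Graph n → Set
MaximalOuterplanar G =
  IsOuterplanar (adj G) ×
  (∀ u v → u ≢ v → adj G u v ≡ false → ¬ IsOuterplanar (addEdge (adj G) u v))

_≡ᵇ_ : ℕ → ℕ → Bool
m ≡ᵇ k = ⌊ m ℕ.≟ k ⌋

OuterPair : ∀ {n} → (Fin n → Fin n) → Fin n → Fin n → Bool
OuterPair {n} pos u v =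
  (suc i ≡ᵇ j) ∨ (suc j ≡ᵇ i) ∨ ((i ≡ᵇ 0) ∧ (suc j ≡ᵇ n)) ∨ ((j ≡ᵇ 0) ∧ (suc i ≡ᵇ n))
  where i = toℕ (pos u); j = toℕ (pos v)

-- adjacency of G' (chords only) with respect to the drawing pos
chordAdj : ∀ {n} → Graph n → (Fin n → Fin n) → Fin n → Fin n → Bool
chordAdj G pos u v = adj G u v ∧ not (OuterPair pos u v)

anyV : ∀ {n} → (Fin n → Bool) → Bool
anyV {n} p = foldr (λ x r → p x ∨ r) false (allFin n)

countV : ∀ {n} → (Fin n → Bool) → ℕ
countV {n} p = foldr (λ x r → if p x then suc r else r) 0 (allFin n)

neq : ∀ {n} → Fin n → Fin n → Bool
neq x y = not ⌊ x ≟ y ⌋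

OnChord4Cycle : ∀ {n} → Graph n → (Fin n → Fin n) → Fin n → Bool
OnChord4Cycle G pos v = anyV λ a → anyV λ b → anyV λ c →
  neq v a ∧ neq v b ∧ neq v c ∧ neq a b ∧ neq a c ∧ neq b c ∧
  E v a ∧ E a b ∧ E b c ∧ E c v
  where E = chordAdj G pos

degree : ∀ {n} → Graph n → Fin n → ℕ
degree G v = countV (adj G v)

sizeA : ∀ {n} → Graph n → (Fin n → Fin n) → ℕ
sizeA G pos = countV (OnChord4Cycle G pos)

sizeB2 : ∀ {n} → Graph n → ℕ
sizeB2 G = countV (λ v → degree G v ≡ᵇ 2)

-- Relabel the vertices by their positions on the circle, so that G becomes a triangulation of the
-- convex polygon 0, …, n-1 whose diagonals form G′. For an edge ij with i + 1 < j let k be the apex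
-- of the triangle on ij inside [i, j]. A chord 4-cycle with all vertices in [i, j] lies in [i, k] or
-- in [k, j], or it is i p k j or i k q j. Induction over the triangles shows that twice the number of
-- ears (vertices on no chord) strictly between i and j is at least 2 plus the number of vertices of
-- [i, j] on such 4-cycles, and at least 4 plus the number strictly inside when some vertex between
-- them is joined to both i and j by chords.
-- At the outer edge from 0 to n-1 the two halves add up to |A| + 4 ≤ 2·#ears, and the ears are
-- exactly the vertices of degree 2.
module Submission where

open import Data.Bool using (Bool; true; false; _∧_; _∨_; not; T; if_then_else_)
open import Data.Bool.Properties using (T-∧; T-∨)
open import Data.Empty using (⊥; ⊥-elim)
open import Data.Fin as Fin using (Fin; zero; suc; toℕ; fromℕ<; punchOut)
open import Data.Fin.Permutation using (permutation)
open import Data.Fin.Properties using (toℕ-fromℕ<; fromℕ<-toℕ; toℕ-injective; toℕ<n; punchOut-injective; any?; pigeonhole)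
open import Data.List using (_∷_; foldr; tabulate; allFin)
open import Data.Nat using (ℕ; zero; suc; _+_; _*_; _∸_; _≤_; _<_; z≤n; s≤s; _≤?_; _<?_; _≤ᵇ_; pred; >-nonZero)
open import Data.Nat.Properties
open import Data.Nat.Tactic.RingSolver using (solve-∀)
open import Algebra.Properties.CommutativeSemigroup +-commutativeSemigroup using (interchange)
open import Algebra.Properties.CommutativeMonoid.Sum +-0-commutativeMonoid using (sum; sum-permute; sum-cong-≗)
open import Data.Product using (Σ; _×_; _,_; proj₁; proj₂)
import Data.Product
open import Data.Sum using (_⊎_; inj₁; inj₂; [_,_]′)
import Data.Sum
open import Data.Unit using (tt)
open import Function using (_∘_; id)
open import Function.Bundles using (Equivalence)
open import Function.Definitions using (Injective)
open import Relation.Binary.Definitions using (tri<; tri≈; tri>)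
open import Relation.Binary.PropositionalEquality
open import Relation.Nullary using (¬_; yes; no)
open import Relation.Nullary.Decidable using (⌊_⌋; toWitness; fromWitness; toWitnessFalse; Dec; _×-dec_; ¬?; T?)
open import Defs hiding (sym; irrefl)

open Equivalence using (to; from)

bit : Bool → ℕ
bit true = 1
bit false = 0

bit-T : ∀ {b} → T b → bit b ≡ 1
bit-T {true} _ = refl

¬T⇒≡false : ∀ {b} → ¬ T b → b ≡ false
¬T⇒≡false {true} ¬b = ⊥-elim (¬b tt)
¬T⇒≡false {false} _ = refl

bit-¬T : ∀ {b} → ¬ T b → bit b ≡ 0
bit-¬T = cong bit ∘ ¬T⇒≡false

bit-mono : ∀ {a b} → (T a → T b) → bit a ≤ bit b
bit-mono {true} {true} _ = ≤-refl
bit-mono {true} {false} a⇒b = ⊥-elim (a⇒b tt)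
bit-mono {false} _ = z≤n

T-∨-¬ʳ : ∀ {a b} → T (a ∨ b) → ¬ T b → T a
T-∨-¬ʳ t ¬b = [ id , ⊥-elim ∘ ¬b ]′ (to T-∨ t)

T-∨-¬ˡ : ∀ {a b} → T (a ∨ b) → ¬ T a → T b
T-∨-¬ˡ t ¬a = [ ⊥-elim ∘ ¬a , id ]′ (to T-∨ t)

¬T-∨ : ∀ {a b} → ¬ T a → ¬ T b → ¬ T (a ∨ b)
¬T-∨ ¬a ¬b t = [ ¬a , ¬b ]′ (to T-∨ t)

bit-∨ : ∀ a b → bit (a ∨ b) ≤ bit a + bit b
bit-∨ true b = s≤s z≤n
bit-∨ false b = ≤-refl

countFrom : (ℕ → Bool) → ℕ → ℕ → ℕ
countFrom p a zero = 0
countFrom p a (suc l) = bit (p a) + countFrom p (suc a) l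

countFrom-+ : ∀ p a l m → countFrom p a (l + m) ≡ countFrom p a l + countFrom p (a + l) m
countFrom-+ p a zero m = cong (λ z → countFrom p z m) (sym (+-identityʳ a))
countFrom-+ p a (suc l) m = begin
    bit (p a) + countFrom p (suc a) (l + m)
  ≡⟨ cong (bit (p a) +_) (countFrom-+ p (suc a) l m) ⟩
    bit (p a) + (countFrom p (suc a) l + countFrom p (suc a + l) m)
  ≡⟨ sym (+-assoc (bit (p a)) _ _) ⟩
    bit (p a) + countFrom p (suc a) l + countFrom p (suc a + l) m
  ≡⟨ cong (λ z → bit (p a) + countFrom p (suc a) l + countFrom p z m) (sym (+-suc a l)) ⟩
    bit (p a) + countFrom p (suc a) l + countFrom p (a + suc l) m ∎
  where open ≡-Reasoning

private
  below-bound : ∀ {a b x} → a ≤ x → x < a + (b ∸ a) → x < b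
  below-bound {a} {b} {x} a≤x x<a+l with a ≤? b
  ... | yes a≤b = subst (x <_) (m+[n∸m]≡n a≤b) x<a+l
  ... | no a≰b = ⊥-elim (<⇒≱ x<a+l (subst (_≤ x) (sym a+0≡a) a≤x))
    where
    a+0≡a : a + (b ∸ a) ≡ a
    a+0≡a = trans (cong (a +_) (m≤n⇒m∸n≡0 (<⇒≤ (≰⇒> a≰b)))) (+-identityʳ a)

  shift-bound : ∀ {a l x} → x < suc a + l → x < a + suc l
  shift-bound {a} {l} {x} = subst (x <_) (sym (+-suc a l))

  head-bound : ∀ a l → a < a + suc l
  head-bound a l = shift-bound (s≤s (m≤m+n a l))

countFrom-mono : ∀ p q a l → (∀ x → a ≤ x → x < a + l → T (p x) → T (q x)) → countFrom p a l ≤ countFrom q a l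
countFrom-mono p q a zero _ = z≤n
countFrom-mono p q a (suc l) p⇒q =
  +-mono-≤ (bit-mono (p⇒q a ≤-refl (head-bound a l)))
           (countFrom-mono p q (suc a) l (λ x a<x x<a+l → p⇒q x (<⇒≤ a<x) (shift-bound x<a+l)))

countFrom-none : ∀ p a l → (∀ x → a ≤ x → x < a + l → ¬ T (p x)) → countFrom p a l ≡ 0
countFrom-none p a zero _ = refl
countFrom-none p a (suc l) none with p a in pa
... | true = ⊥-elim (none a ≤-refl (head-bound a l) (subst T (sym pa) tt))
... | false = countFrom-none p (suc a) l (λ x a<x x<l → none x (<⇒≤ a<x) (shift-bound x<l))

countFrom-∨ : ∀ p q a l → countFrom (λ x → p x ∨ q x) a l ≤ countFrom p a l + countFrom q a l
countFrom-∨ p q a zero = z≤n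
countFrom-∨ p q a (suc l) = begin
    bit (p a ∨ q a) + countFrom (λ x → p x ∨ q x) (suc a) l
  ≤⟨ +-mono-≤ (bit-∨ (p a) (q a)) (countFrom-∨ p q (suc a) l) ⟩
    (bit (p a) + bit (q a)) + (countFrom p (suc a) l + countFrom q (suc a) l)
  ≡⟨ interchange (bit (p a)) (bit (q a)) (countFrom p (suc a) l) (countFrom q (suc a) l) ⟩
    (bit (p a) + countFrom p (suc a) l) + (bit (q a) + countFrom q (suc a) l) ∎
  where open ≤-Reasoning

countFrom-atMostOne : ∀ p B a l →
  (∀ x y → a ≤ x → x < a + l → a ≤ y → y < a + l → T (p x) → T (p y) → x ≡ y) →
  (∀ x → a ≤ x → x < a + l → T (p x) → T B) → countFrom p a l ≤ bit B
countFrom-atMostOne p B a zero _ _ = z≤n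
countFrom-atMostOne p B a (suc l) unique witness with p a in pa
... | false = countFrom-atMostOne p B (suc a) l
                (λ x y a<x x<l a<y y<l → unique x y (<⇒≤ a<x) (shift-bound x<l) (<⇒≤ a<y) (shift-bound y<l))
                (λ x a<x x<l → witness x (<⇒≤ a<x) (shift-bound x<l))
... | true rewrite bit-T (witness a ≤-refl (head-bound a l) (subst T (sym pa) tt)) =
  s≤s (≤-reflexive (countFrom-none p (suc a) l rest-empty))
  where
  rest-empty : ∀ x → suc a ≤ x → x < suc a + l → ¬ T (p x)
  rest-empty x a<x x<l px =
    <-irrefl (unique a x ≤-refl (head-bound a l) (<⇒≤ a<x) (shift-bound x<l) (subst T (sym pa) tt) px) a<x

-- Opaque, so that lemmas about `2 * e` apply to counts by unification.
opaque
  count : (ℕ → Bool) → ℕ → ℕ → ℕ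
  count p a b = countFrom p a (b ∸ a)

opaque
  unfolding count

  count-split : ∀ p {a b c} → a ≤ b → b ≤ c → count p a c ≡ count p a b + count p b c
  count-split p {a} {b} {c} a≤b b≤c = begin
      countFrom p a (c ∸ a)
    ≡⟨ cong (countFrom p a) c∸a≡ ⟩
      countFrom p a ((b ∸ a) + (c ∸ b))
    ≡⟨ countFrom-+ p a (b ∸ a) (c ∸ b) ⟩
      countFrom p a (b ∸ a) + countFrom p (a + (b ∸ a)) (c ∸ b)
    ≡⟨ cong (λ z → countFrom p a (b ∸ a) + countFrom p z (c ∸ b)) (m+[n∸m]≡n a≤b) ⟩
      countFrom p a (b ∸ a) + countFrom p b (c ∸ b) ∎
    where
    open ≡-Reasoning
    c∸a≡ : c ∸ a ≡ (b ∸ a) + (c ∸ b)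
    c∸a≡ = trans (cong (_∸ a) (sym (m+[n∸m]≡n b≤c))) (+-∸-comm (c ∸ b) a≤b)

  count-singleton : ∀ p a → count p a (suc a) ≡ bit (p a)
  count-singleton p a = trans (cong (countFrom p a) (m+n∸n≡m 1 a)) (+-identityʳ _)

  count-empty : ∀ p a → count p a a ≡ 0
  count-empty p a = cong (countFrom p a) (n∸n≡0 a)

  count-mono : ∀ p q a b → (∀ x → a ≤ x → x < b → T (p x) → T (q x)) → count p a b ≤ count q a b
  count-mono p q a b p⇒q = countFrom-mono p q a (b ∸ a) (λ x a≤x x<a+l → p⇒q x a≤x (below-bound a≤x x<a+l))

  count-none : ∀ p a b → (∀ x → a ≤ x → x < b → ¬ T (p x)) → count p a b ≡ 0
  count-none p a b none = countFrom-none p a (b ∸ a) (λ x a≤x x<a+l → none x a≤x (below-bound a≤x x<a+l))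

  count-∨ : ∀ p q a b → count (λ x → p x ∨ q x) a b ≤ count p a b + count q a b
  count-∨ p q a b = countFrom-∨ p q a (b ∸ a)

  count-atMostOne : ∀ p B a b →
    (∀ x y → a ≤ x → x < b → a ≤ y → y < b → T (p x) → T (p y) → x ≡ y) →
    (∀ x → a ≤ x → x < b → T (p x) → T B) → count p a b ≤ bit B
  count-atMostOne p B a b unique witness =
    countFrom-atMostOne p B a (b ∸ a)
      (λ x y a≤x x<l a≤y y<l → unique x y a≤x (below-bound a≤x x<l) a≤y (below-bound a≤y y<l))
      (λ x a≤x x<l → witness x a≤x (below-bound a≤x x<l))

count-cut : ∀ p {a b k} → a ≤ k → k < b →
            count p a b ≡ count p a k + (bit (p k) + count p (suc k) b)
count-cut p {a} {b} {k} a≤k k<b =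
  trans (count-split p a≤k (<⇒≤ k<b))
        (cong (count p a k +_) (trans (count-split p (n≤1+n k) k<b) (cong (_+ count p (suc k) b) (count-singleton p k))))

count-ends : ∀ p {a b} → a < b → count p a (suc b) ≡ bit (p a) + (count p (suc a) b + bit (p b))
count-ends p {a} {b} a<b =
  trans (count-split p (n≤1+n a) (<⇒≤ (s≤s a<b)))
        (cong₂ _+_ (count-singleton p a) (trans (count-split p a<b (n≤1+n b)) (cong (count p (suc a) b +_) (count-singleton p b))))

count-two : ∀ p {u v m} → u < v → v < m → T (p u) → T (p v) →
            (∀ y → y < m → y ≢ u → y ≢ v → ¬ T (p y)) → count p 0 m ≡ 2
count-two p {u} {v} {m} u<v v<m pu pv others = begin
    count p 0 m
  ≡⟨ count-cut p z≤n u<m ⟩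
    count p 0 u + (bit (p u) + count p (suc u) m)
  ≡⟨ cong (λ z → count p 0 u + (bit (p u) + z)) (count-cut p u<v v<m) ⟩
    count p 0 u + (bit (p u) + (count p (suc u) v + (bit (p v) + count p (suc v) m)))
  ≡⟨ cong₂ (λ x y → x + (y + (count p (suc u) v + (bit (p v) + count p (suc v) m)))) below-u (bit-T pu) ⟩
    1 + (count p (suc u) v + (bit (p v) + count p (suc v) m))
  ≡⟨ cong₂ (λ x y → 1 + (x + (y + count p (suc v) m))) between (bit-T pv) ⟩
    2 + count p (suc v) m
  ≡⟨ cong (2 +_) above-v ⟩
    2 ∎
  where
  open ≡-Reasoning
  u<m = <-trans u<v v<m
  below-u : count p 0 u ≡ 0
  below-u = count-none p 0 u (λ y _ y<u → others y (<-trans y<u u<m) (<⇒≢ y<u) (<⇒≢ (<-trans y<u u<v)))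
  between : count p (suc u) v ≡ 0
  between = count-none p (suc u) v (λ y u<y y<v → others y (<-trans y<v v<m) (≢-sym (<⇒≢ u<y)) (<⇒≢ y<v))
  above-v : count p (suc v) m ≡ 0
  above-v = count-none p (suc v) m (λ y v<y y<m → others y y<m (≢-sym (<⇒≢ (<-trans u<v v<y))) (≢-sym (<⇒≢ v<y)))

anyBelow : (ℕ → Bool) → ℕ → Bool
anyBelow p zero = false
anyBelow p (suc m) = p m ∨ anyBelow p m

anyBelow-sound : ∀ p m → T (anyBelow p m) → Σ ℕ λ y → y < m × T (p y)
anyBelow-sound p (suc m) t with to T-∨ t
... | inj₁ pm = m , ≤-refl , pm
... | inj₂ rest with anyBelow-sound p m rest
... | y , y<m , py = y , m<n⇒m<1+n y<m , py

anyBelow-complete : ∀ p m y → y < m → T (p y) → T (anyBelow p m)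
anyBelow-complete p (suc m) y y<1+m py with y Data.Nat.≟ m
... | yes refl = from T-∨ (inj₁ py)
... | no y≢m = from T-∨ (inj₂ (anyBelow-complete p m y (≤∧≢⇒< (≤-pred y<1+m) y≢m) py))

countV-sum : ∀ {n} (p : Fin n → Bool) → countV p ≡ sum (bit ∘ p)
countV-sum p = foldr-tabulate p id
  where
  foldr-tabulate : ∀ {n m} (p : Fin n → Bool) (f : Fin m → Fin n) →
                   foldr (λ x r → if p x then suc r else r) 0 (tabulate f) ≡ sum (bit ∘ p ∘ f)
  foldr-tabulate {m = zero} p f = refl
  foldr-tabulate {m = suc m} p f with p (f zero)
  ... | true = cong suc (foldr-tabulate p (f ∘ suc))
  ... | false = foldr-tabulate p (f ∘ suc)

countV-mono : ∀ {n} (p q : Fin n → Bool) → (∀ v → T (p v) → T (q v)) → countV p ≤ countV q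
countV-mono p q p⇒q = subst₂ _≤_ (sym (countV-sum p)) (sym (countV-sum q)) (sum-mono (λ v → bit-mono (p⇒q v)))
  where
  sum-mono : ∀ {n} {f g : Fin n → ℕ} → (∀ i → f i ≤ g i) → sum f ≤ sum g
  sum-mono {zero} _ = z≤n
  sum-mono {suc n} f≤g = +-mono-≤ (f≤g zero) (sum-mono (f≤g ∘ suc))

countV-cong : ∀ {n} (p q : Fin n → Bool) → (∀ v → p v ≡ q v) → countV p ≡ countV q
countV-cong p q p≗q = trans (countV-sum p) (trans (sum-cong-≗ (cong bit ∘ p≗q)) (sym (countV-sum q)))

opaque
  unfolding count

  countV-as-count : ∀ {n} (p : Fin n → Bool) (q : ℕ → Bool) → (∀ i → q (toℕ i) ≡ p i) → countV p ≡ count q 0 n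
  countV-as-count {n} p q q≗p = trans (countV-sum p) (sum-as-countFrom p 0 (λ i → trans (cong q (+-identityʳ (toℕ i))) (q≗p i)))
    where
    sum-as-countFrom : ∀ {m} (f : Fin m → Bool) a → (∀ i → q (toℕ i + a) ≡ f i) → sum (bit ∘ f) ≡ countFrom q a m
    sum-as-countFrom {zero} f a _ = refl
    sum-as-countFrom {suc m} f a q≗f =
      cong₂ _+_ (cong bit (sym (q≗f zero)))
                (sum-as-countFrom (f ∘ suc) (suc a) (λ i → trans (cong q (+-suc (toℕ i) a)) (q≗f (suc i))))

injective⇒surjective : ∀ {n} (f : Fin n → Fin n) → Injective _≡_ _≡_ f → ∀ t → Σ (Fin n) λ v → f v ≡ t
injective⇒surjective {suc m} f f-inj t with any? (λ v → f v Fin.≟ t)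
... | yes hit = hit
... | no miss with pigeonhole (n<1+n m) (λ v → punchOut {i = t} {j = f v} (λ t≡fv → miss (v , sym t≡fv)))
... | i , j , i<j , punch≡ =
  ⊥-elim (<-irrefl (cong toℕ (f-inj (punchOut-injective (λ e → miss (i , sym e)) (λ e → miss (j , sym e)) punch≡))) i<j)

countV-permute : ∀ {n} (f : Fin n → Fin n) → Injective _≡_ _≡_ f → (p : Fin n → Bool) → countV (p ∘ f) ≡ countV p
countV-permute f f-inj p =
  trans (countV-sum (p ∘ f)) (trans (sym (sum-permute (bit ∘ p) (permutation f f⁻¹ f∘f⁻¹ f⁻¹∘f))) (sym (countV-sum p)))
  where
  f⁻¹ = λ t → proj₁ (injective⇒surjective f f-inj t)
  f∘f⁻¹ : ∀ t → f (f⁻¹ t) ≡ t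
  f∘f⁻¹ t = proj₂ (injective⇒surjective f f-inj t)
  f⁻¹∘f : ∀ v → f⁻¹ (f v) ≡ v
  f⁻¹∘f v = f-inj (f∘f⁻¹ (f v))

anyV-sound : ∀ {n} (p : Fin n → Bool) → T (anyV p) → Σ (Fin n) (T ∘ p)
anyV-sound {n} p = search (allFin n)
  where
  search : ∀ xs → T (foldr (λ x r → p x ∨ r) false xs) → Σ (Fin n) (T ∘ p)
  search (x ∷ xs) t = [ (x ,_) , search xs ]′ (to (T-∨ {p x}) t)

addEdge-cases : ∀ {n} (a : Fin n → Fin n → Bool) u v {x y} → T (addEdge a u v x y) →
                T (a x y) ⊎ (x ≡ u × y ≡ v) ⊎ (x ≡ v × y ≡ u)
addEdge-cases a u v {x} {y} t with to (T-∨ {a x y}) t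
... | inj₁ old = inj₁ old
... | inj₂ new with to (T-∨ {⌊ x Fin.≟ u ⌋ ∧ ⌊ y Fin.≟ v ⌋}) new
...   | inj₁ xy≡uv = let (x≡u , y≡v) = to (T-∧ {⌊ x Fin.≟ u ⌋}) xy≡uv in inj₂ (inj₁ (toWitness x≡u , toWitness y≡v))
...   | inj₂ xy≡vu = let (x≡v , y≡u) = to (T-∧ {⌊ x Fin.≟ v ⌋}) xy≡vu in inj₂ (inj₂ (toWitness x≡v , toWitness y≡u))

Cross-swapˡ : ∀ {n} (pos : Fin n → Fin n) {p q r s} → Cross pos p q r s → Cross pos q p r s
Cross-swapˡ pos (r≢p , r≢q , s≢p , s≢q , inj₁ (r-in , s-out)) = r≢q , r≢p , s≢q , s≢p , inj₁ (Data.Sum.swap r-in , s-out ∘ Data.Sum.swap)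
Cross-swapˡ pos (r≢p , r≢q , s≢p , s≢q , inj₂ (r-out , s-in)) = r≢q , r≢p , s≢q , s≢p , inj₂ (r-out ∘ Data.Sum.swap , Data.Sum.swap s-in)

Cross-swapʳ : ∀ {n} (pos : Fin n → Fin n) {p q r s} → Cross pos p q r s → Cross pos p q s r
Cross-swapʳ pos (r≢p , r≢q , s≢p , s≢q , inj₁ rs) = s≢p , s≢q , r≢p , r≢q , inj₂ (Data.Product.swap rs)
Cross-swapʳ pos (r≢p , r≢q , s≢p , s≢q , inj₂ rs) = s≢p , s≢q , r≢p , r≢q , inj₁ (Data.Product.swap rs)

addEdge-noncrossing : ∀ {n} {pos : Fin n → Fin n} {a} u v → NonCrossing pos a →
  (∀ x y → T (a x y) → ¬ Cross pos u v x y) → (∀ x y → T (a x y) → ¬ Cross pos x y u v) →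
  NonCrossing pos (addEdge a u v)
addEdge-noncrossing {pos = pos} {a} u v nc new-old old-new u′ v′ x y t₁ t₂ cross
  with addEdge-cases a u v t₁ | addEdge-cases a u v t₂
... | inj₁ old₁ | inj₁ old₂ = nc u′ v′ x y old₁ old₂ cross
... | inj₂ (inj₁ (refl , refl)) | inj₁ old = new-old x y old cross
... | inj₂ (inj₂ (refl , refl)) | inj₁ old = new-old x y old (Cross-swapˡ pos cross)
... | inj₁ old | inj₂ (inj₁ (refl , refl)) = old-new u′ v′ old cross
... | inj₁ old | inj₂ (inj₂ (refl , refl)) = old-new u′ v′ old (Cross-swapʳ pos cross)
... | inj₂ (inj₁ (refl , refl)) | inj₂ (inj₁ (refl , refl)) = proj₁ cross refl
... | inj₂ (inj₁ (refl , refl)) | inj₂ (inj₂ (refl , refl)) = proj₁ (proj₂ cross) refl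
... | inj₂ (inj₂ (refl , refl)) | inj₂ (inj₁ (refl , refl)) = proj₁ (proj₂ cross) refl
... | inj₂ (inj₂ (refl , refl)) | inj₂ (inj₂ (refl , refl)) = proj₁ cross refl

Inside : ℕ → ℕ → ℕ → Set
Inside P Q Z = (P < Z × Z < Q) ⊎ (Q < Z × Z < P)

ExactlyOneInside : ℕ → ℕ → ℕ → ℕ → Set
ExactlyOneInside P Q X Y = (Inside P Q X × ¬ Inside P Q Y) ⊎ (¬ Inside P Q X × Inside P Q Y)

Outside : ℕ → ℕ → ℕ → Set
Outside P Q Z = Z < P ⊎ Q < Z

¬Inside⇒Outside : ∀ {P Q Z} → P < Q → Z ≢ P → Z ≢ Q → ¬ Inside P Q Z → Outside P Q Z
¬Inside⇒Outside {P} {Q} {Z} P<Q Z≢P Z≢Q ¬in with <-cmp Z P | <-cmp Z Q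
... | tri< Z<P _ _ | _ = inj₁ Z<P
... | tri≈ _ Z≡P _ | _ = ⊥-elim (Z≢P Z≡P)
... | tri> _ _ P<Z | tri< Z<Q _ _ = ⊥-elim (¬in (inj₁ (P<Z , Z<Q)))
... | tri> _ _ _ | tri≈ _ Z≡Q _ = ⊥-elim (Z≢Q Z≡Q)
... | tri> _ _ _ | tri> _ _ Q<Z = inj₂ Q<Z

Inside⇒between : ∀ {P Q Z} → P < Q → Inside P Q Z → P < Z × Z < Q
Inside⇒between P<Q (inj₁ between) = between
Inside⇒between P<Q (inj₂ (Q<Z , Z<P)) = ⊥-elim (<-asym P<Q (<-trans Q<Z Z<P))

exactlyOneInside-swap : ∀ {a b P Q} → a < b → P ≢ a → P ≢ b → Q ≢ a → Q ≢ b →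
                        ExactlyOneInside P Q a b → ExactlyOneInside a b P Q
exactlyOneInside-swap {a} {b} {P} {Q} a<b P≢a P≢b Q≢a Q≢b (inj₁ (inj₁ (P<a , a<Q) , b-out)) with <-cmp b Q
... | tri< b<Q _ _ = ⊥-elim (b-out (inj₁ (<-trans P<a a<b , b<Q)))
... | tri≈ _ b≡Q _ = ⊥-elim (Q≢b (sym b≡Q))
... | tri> _ _ Q<b = inj₂ ([ (λ (a<P , _) → <-asym a<P P<a) , (λ (b<P , _) → <-asym b<P (<-trans P<a a<b)) ]′ , inj₁ (a<Q , Q<b))
exactlyOneInside-swap {a} {b} {P} {Q} a<b P≢a P≢b Q≢a Q≢b (inj₁ (inj₂ (Q<a , a<P) , b-out)) with <-cmp b P
... | tri< b<P _ _ = ⊥-elim (b-out (inj₂ (<-trans Q<a a<b , b<P)))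
... | tri≈ _ b≡P _ = ⊥-elim (P≢b (sym b≡P))
... | tri> _ _ P<b = inj₁ (inj₁ (a<P , P<b) , [ (λ (a<Q , _) → <-asym a<Q Q<a) , (λ (b<Q , _) → <-asym b<Q (<-trans Q<a a<b)) ]′)
exactlyOneInside-swap {a} {b} {P} {Q} a<b P≢a P≢b Q≢a Q≢b (inj₂ (a-out , inj₁ (P<b , b<Q))) with <-cmp a P
... | tri< a<P _ _ = inj₁ (inj₁ (a<P , P<b) , [ (λ (_ , Q<b) → <-asym Q<b b<Q) , (λ (_ , Q<a) → <-asym Q<a (<-trans a<b b<Q)) ]′)
... | tri≈ _ a≡P _ = ⊥-elim (P≢a (sym a≡P))
... | tri> _ _ P<a = ⊥-elim (a-out (inj₁ (P<a , <-trans a<b b<Q)))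
exactlyOneInside-swap {a} {b} {P} {Q} a<b P≢a P≢b Q≢a Q≢b (inj₂ (a-out , inj₂ (Q<b , b<P))) with <-cmp a Q
... | tri< a<Q _ _ = inj₂ ([ (λ (_ , P<b) → <-asym P<b b<P) , (λ (_ , P<a) → <-asym P<a (<-trans a<b b<P)) ]′ , inj₁ (a<Q , Q<b))
... | tri≈ _ a≡Q _ = ⊥-elim (Q≢a (sym a≡Q))
... | tri> _ _ Q<a = ⊥-elim (a-out (inj₂ (Q<a , <-trans a<b b<P)))

IsPair : ℕ → ℕ → ℕ → ℕ → Set
IsPair X Y c d = (c ≡ X × d ≡ Y) ⊎ (c ≡ Y × d ≡ X)

one-inside-one-outside : ∀ {P Q X Y} → P < Q → X ≢ P → X ≢ Q → Y ≢ P → Y ≢ Q → ExactlyOneInside P Q X Y →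
                         Σ ℕ λ c → Σ ℕ λ d → P < c × c < Q × Outside P Q d × IsPair X Y c d
one-inside-one-outside {X = X} {Y} P<Q X≢P X≢Q Y≢P Y≢Q (inj₁ (X-in , Y-out)) =
  let (P<X , X<Q) = Inside⇒between P<Q X-in in X , Y , P<X , X<Q , ¬Inside⇒Outside P<Q Y≢P Y≢Q Y-out , inj₁ (refl , refl)
one-inside-one-outside {X = X} {Y} P<Q X≢P X≢Q Y≢P Y≢Q (inj₂ (X-out , Y-in)) =
  let (P<Y , Y<Q) = Inside⇒between P<Q Y-in in Y , X , P<Y , Y<Q , ¬Inside⇒Outside P<Q X≢P X≢Q X-out , inj₂ (refl , refl)

≤-by-evaluation : ∀ {m n} {m≤ᵇn : T (m ≤ᵇ n)} → m ≤ n
≤-by-evaluation {m} {n} {m≤ᵇn} = ≤ᵇ⇒≤ m n m≤ᵇn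

-- The lower bound on 2·ears − squares that the invariant gives a side polygon of a triangle,
-- depending on whether it has a chord apex and whether its shared vertex lies on a square.
budget : Bool → Bool → ℕ
budget true _ = 4
budget false a = 2 + bit a

budget-shared-vertex : ∀ aₗ aᵣ fₗ fᵣ → bit fₗ + bit (aₗ ∨ aᵣ ∨ fₗ ∨ fᵣ) + bit fᵣ + 4 ≤ budget fₗ aₗ + budget fᵣ aᵣ
budget-shared-vertex true  true  true  true  = ≤-by-evaluation
budget-shared-vertex true  true  true  false = ≤-by-evaluation
budget-shared-vertex true  true  false true  = ≤-by-evaluation
budget-shared-vertex true  true  false false = ≤-by-evaluation
budget-shared-vertex true  false true  true  = ≤-by-evaluation
budget-shared-vertex true  false true  false = ≤-by-evaluation
budget-shared-vertex true  false false true  = ≤-by-evaluation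
budget-shared-vertex true  false false false = ≤-by-evaluation
budget-shared-vertex false true  true  true  = ≤-by-evaluation
budget-shared-vertex false true  true  false = ≤-by-evaluation
budget-shared-vertex false true  false true  = ≤-by-evaluation
budget-shared-vertex false true  false false = ≤-by-evaluation
budget-shared-vertex false false true  true  = ≤-by-evaluation
budget-shared-vertex false false true  false = ≤-by-evaluation
budget-shared-vertex false false false true  = ≤-by-evaluation
budget-shared-vertex false false false false = ≤-by-evaluation

budget-left : ∀ {S E s} a f → s + (S + bit a) + 2 ≤ E → (T f → S + 4 ≤ E) → S + budget f a ≤ E
budget-left a true _ apex = apex tt
budget-left {S} {E} {s} a false ends _ = ≤-trans (≤-trans (m≤n+m (S + (2 + bit a)) s) (≤-reflexive (rearrange s S (bit a)))) ends
  where
  rearrange : ∀ s S a → s + (S + (2 + a)) ≡ s + (S + a) + 2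
  rearrange = solve-∀

budget-right : ∀ {S E s} a f → bit a + (S + s) + 2 ≤ E → (T f → S + 4 ≤ E) → S + budget f a ≤ E
budget-right {S} {E} {s} a f ends = budget-left {S} {E} {s} a f (≤-trans (≤-reflexive (rearrange s S (bit a))) ends)
  where
  rearrange : ∀ s S a → s + (S + a) + 2 ≡ a + (S + s) + 2
  rearrange = solve-∀

both-sides-step : ∀ {S Sₗ Sᵣ Eₗ Eᵣ sₖ} aₗ aᵣ fₗ fᵣ →
  S ≤ (Sₗ + bit fₗ) + (sₖ + (Sᵣ + bit fᵣ)) → sₖ ≤ bit (aₗ ∨ aᵣ ∨ fₗ ∨ fᵣ) →
  Sₗ + budget fₗ aₗ ≤ Eₗ → Sᵣ + budget fᵣ aᵣ ≤ Eᵣ → S + 4 ≤ Eₗ + Eᵣ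
both-sides-step {S} {Sₗ} {Sᵣ} {Eₗ} {Eᵣ} {sₖ} aₗ aᵣ fₗ fᵣ S≤ sₖ≤ left right = begin
    S + 4
  ≤⟨ +-monoˡ-≤ 4 (≤-trans S≤ (+-monoʳ-≤ (Sₗ + bit fₗ) (+-monoˡ-≤ (Sᵣ + bit fᵣ) sₖ≤))) ⟩
    (Sₗ + bit fₗ) + (Q + (Sᵣ + bit fᵣ)) + 4
  ≡⟨ rearrange Sₗ Sᵣ (bit fₗ) Q (bit fᵣ) ⟩
    (Sₗ + Sᵣ) + (bit fₗ + Q + bit fᵣ + 4)
  ≤⟨ +-monoʳ-≤ (Sₗ + Sᵣ) (budget-shared-vertex aₗ aᵣ fₗ fᵣ) ⟩
    (Sₗ + Sᵣ) + (budget fₗ aₗ + budget fᵣ aᵣ)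
  ≡⟨ interchange Sₗ Sᵣ (budget fₗ aₗ) (budget fᵣ aᵣ) ⟩
    (Sₗ + budget fₗ aₗ) + (Sᵣ + budget fᵣ aᵣ)
  ≤⟨ +-mono-≤ left right ⟩
    Eₗ + Eᵣ ∎
  where
  open ≤-Reasoning
  Q = bit (aₗ ∨ aᵣ ∨ fₗ ∨ fᵣ)
  rearrange : ∀ a b c d e → ((a + c) + (d + (b + e))) + 4 ≡ (a + b) + (c + d + e + 4)
  rearrange = solve-∀

ends-from-interior : ∀ {S E} a b → S + 4 ≤ E → bit a + (S + bit b) + 2 ≤ E
ends-from-interior {S} a b S+4≤ = ≤-trans (≤-trans (≤-reflexive (rearrange (bit a) S (bit b))) (+-monoʳ-≤ S (two-bits a b))) S+4≤
  where
  rearrange : ∀ a S b → a + (S + b) + 2 ≡ S + (a + b + 2)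
  rearrange = solve-∀
  two-bits : ∀ a b → bit a + bit b + 2 ≤ 4
  two-bits true  true  = ≤-by-evaluation
  two-bits true  false = ≤-by-evaluation
  two-bits false true  = ≤-by-evaluation
  two-bits false false = ≤-by-evaluation

drop-flags : ∀ {S A f s B g} → S ≤ (A + f) + (s + (B + g)) → f ≡ 0 → g ≡ 0 → S ≤ A + (s + B)
drop-flags {S} {A} {s = s} {B} S≤ refl refl = subst (S ≤_) (rearrange A s B) S≤
  where
  rearrange : ∀ A s B → (A + 0) + (s + (B + 0)) ≡ A + (s + B)
  rearrange = solve-∀

left-side-ends : ∀ {S Sₗ sₖ Sᵣ a sᵢ sᵢ′ sⱼ E} → S ≤ Sₗ + (sₖ + Sᵣ) → Sᵣ ≡ 0 → sₖ ≤ a → sᵢ ≤ sᵢ′ → sⱼ ≡ 0 →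
                 sᵢ′ + (Sₗ + a) + 2 ≤ E → sᵢ + (S + sⱼ) + 2 ≤ E
left-side-ends {S} {Sₗ} {sₖ} S≤ refl sₖ≤a sᵢ≤ refl = ≤-trans (+-monoˡ-≤ 2 (+-mono-≤ sᵢ≤ S+0≤))
  where
  S+0≤ : S + 0 ≤ Sₗ + _
  S+0≤ = ≤-trans (≤-reflexive (+-identityʳ S)) (≤-trans S≤ (+-monoʳ-≤ Sₗ (≤-trans (≤-reflexive (+-identityʳ sₖ)) sₖ≤a)))

right-side-ends : ∀ {S Sₗ sₖ Sᵣ a sᵢ sⱼ sⱼ′ E} → S ≤ Sₗ + (sₖ + Sᵣ) → Sₗ ≡ 0 → sₖ ≤ a → sᵢ ≡ 0 → sⱼ ≤ sⱼ′ →
                  a + (Sᵣ + sⱼ′) + 2 ≤ E → sᵢ + (S + sⱼ) + 2 ≤ E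
right-side-ends {Sᵣ = Sᵣ} {a} {sⱼ′ = sⱼ′} S≤ refl sₖ≤a refl sⱼ≤ =
  ≤-trans (+-monoˡ-≤ 2 (≤-trans (+-mono-≤ (≤-trans S≤ (+-monoˡ-≤ Sᵣ sₖ≤a)) sⱼ≤) (≤-reflexive (+-assoc a Sᵣ sⱼ′))))

leaf-ends : ∀ {S Sₗ sₖ Sᵣ sᵢ sⱼ E} → S ≤ Sₗ + (sₖ + Sᵣ) → Sₗ ≡ 0 → sₖ ≡ 0 → Sᵣ ≡ 0 → sᵢ ≡ 0 → sⱼ ≡ 0 →
            2 ≤ E → sᵢ + (S + sⱼ) + 2 ≤ E
leaf-ends S≤ refl refl refl refl refl = ≤-trans (+-monoˡ-≤ 2 (+-monoˡ-≤ 0 S≤))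

two-sides-ends : ∀ {S Sₗ sₖ Sᵣ aₗ aᵣ sᵢ sᵢ′ sⱼ sⱼ′ Eₗ Eᵣ} → S ≤ Sₗ + (sₖ + Sᵣ) → sₖ ≤ aₗ + aᵣ → sᵢ ≤ sᵢ′ → sⱼ ≤ sⱼ′ →
                 sᵢ′ + (Sₗ + aₗ) + 2 ≤ Eₗ → aᵣ + (Sᵣ + sⱼ′) + 2 ≤ Eᵣ → sᵢ + (S + sⱼ) + 4 ≤ Eₗ + Eᵣ
two-sides-ends {S} {Sₗ} {sₖ} {Sᵣ} {aₗ} {aᵣ} {sᵢ} {sᵢ′} {sⱼ} {sⱼ′} {Eₗ} {Eᵣ} S≤ sₖ≤ sᵢ≤ sⱼ≤ left right = begin
    sᵢ + (S + sⱼ) + 4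
  ≤⟨ +-monoˡ-≤ 4 (+-mono-≤ sᵢ≤ (+-mono-≤ (≤-trans S≤ (+-monoʳ-≤ Sₗ (+-monoˡ-≤ Sᵣ sₖ≤))) sⱼ≤)) ⟩
    sᵢ′ + ((Sₗ + ((aₗ + aᵣ) + Sᵣ)) + sⱼ′) + 4
  ≡⟨ rearrange sᵢ′ Sₗ aₗ aᵣ Sᵣ sⱼ′ ⟩
    (sᵢ′ + (Sₗ + aₗ) + 2) + (aᵣ + (Sᵣ + sⱼ′) + 2)
  ≤⟨ +-mono-≤ left right ⟩
    Eₗ + Eᵣ ∎
  where
  open ≤-Reasoning
  rearrange : ∀ s S a b T t → s + ((S + ((a + b) + T)) + t) + 4 ≡ (s + (S + a) + 2) + (b + (T + t) + 2)
  rearrange = solve-∀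

plus-ear-at-start : ∀ {X e} E c → X + 2 ≤ 2 * e → e ≤ E → X + 4 ≤ 2 * (1 + (E + c))
plus-ear-at-start {X} {e} E c X+2≤ e≤E = begin
    X + 4
  ≡⟨ sym (+-assoc X 2 2) ⟩
    X + 2 + 2
  ≤⟨ +-monoˡ-≤ 2 (≤-trans X+2≤ (*-monoʳ-≤ 2 (≤-trans e≤E (m≤m+n E c)))) ⟩
    2 * (E + c) + 2
  ≡⟨ rearrange E c ⟩
    2 * (1 + (E + c)) ∎
  where
  open ≤-Reasoning
  rearrange : ∀ E c → 2 * (E + c) + 2 ≡ 2 * (1 + (E + c))
  rearrange = solve-∀

plus-ear-at-end : ∀ {X e} E c → X + 2 ≤ 2 * e → e ≤ E → X + 4 ≤ 2 * (c + (E + 1))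
plus-ear-at-end E c X+2≤ e≤E =
  ≤-trans (plus-ear-at-start E c X+2≤ e≤E) (≤-reflexive (cong (2 *_) (rearrange E c)))
  where
  rearrange : ∀ E c → 1 + (E + c) ≡ c + (E + 1)
  rearrange = solve-∀

record ConvexMaximalOuterplanar (n : ℕ) : Set where
  field
    3≤n          : 3 ≤ n
    edge         : ℕ → ℕ → Bool
    edge-sym     : ∀ a b → edge a b ≡ edge b a
    edge-bounded : ∀ a b → T (edge a b) → b < n
    edge-irrefl  : ∀ a → ¬ T (edge a a)
    non-crossing : ∀ {a c b d} → a < c → c < b → b < d → T (edge a b) → T (edge c d) → ⊥
    saturated    : ∀ {a b} → a < b → b < n → ¬ T (edge a b) →
                   ¬ (∀ {c d} → a < c → c < b → d < n → d < a ⊎ b < d → ¬ T (edge c d))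

module Convex {n : ℕ} (G : ConvexMaximalOuterplanar n) where

  open ConvexMaximalOuterplanar G public

  Edge : ℕ → ℕ → Set
  Edge a b = T (edge a b)

  Edge-sym : ∀ {a b} → Edge a b → Edge b a
  Edge-sym {a} {b} = subst T (edge-sym a b)

  -- Defs.OuterPair read on positions; `chordAdj⇒Chord` relies on the two agreeing definitionally.
  consecutive : ℕ → ℕ → Bool
  consecutive a b =
    (suc a ≡ᵇ b) ∨ (suc b ≡ᵇ a) ∨ ((a ≡ᵇ 0) ∧ (suc b ≡ᵇ n)) ∨ ((b ≡ᵇ 0) ∧ (suc a ≡ᵇ n))

  consecutive-sym : ∀ a b → consecutive a b ≡ consecutive b a
  consecutive-sym a b = swap (suc a ≡ᵇ b) (suc b ≡ᵇ a) ((a ≡ᵇ 0) ∧ (suc b ≡ᵇ n)) ((b ≡ᵇ 0) ∧ (suc a ≡ᵇ n))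
    where
    swap : ∀ w x y z → (w ∨ x ∨ y ∨ z) ≡ (x ∨ w ∨ z ∨ y)
    swap true  true  _     _     = refl
    swap true  false _     _     = refl
    swap false true  _     _     = refl
    swap false false true  true  = refl
    swap false false true  false = refl
    swap false false false true  = refl
    swap false false false false = refl

  chord : ℕ → ℕ → Bool
  chord a b = edge a b ∧ not (consecutive a b)

  Chord : ℕ → ℕ → Set
  Chord a b = T (chord a b)

  Chord-sym : ∀ {a b} → Chord a b → Chord b a
  Chord-sym {a} {b} = subst T (cong₂ (λ e o → e ∧ not o) (edge-sym a b) (consecutive-sym a b))

  Chord⇒Edge : ∀ {a b} → Chord a b → Edge a b
  Chord⇒Edge c = proj₁ (to T-∧ c)

  Chord⇒¬consecutive : ∀ {a b} → Chord a b → ¬ T (consecutive a b)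
  Chord⇒¬consecutive {a} {b} c with consecutive a b
  ... | true = ⊥-elim (proj₂ (to T-∧ c))
  ... | false = λ ()

  Edge⇒¬consecutive⇒Chord : ∀ {a b} → Edge a b → ¬ T (consecutive a b) → Chord a b
  Edge⇒¬consecutive⇒Chord {a} {b} e ¬c with consecutive a b
  ... | true = ⊥-elim (¬c tt)
  ... | false = from T-∧ (e , tt)

  Edge⇒<n : ∀ {a b} → Edge a b → a < n
  Edge⇒<n e = edge-bounded _ _ (Edge-sym e)

  last : ℕ
  last = pred n

  suc-last : suc last ≡ n
  suc-last = suc-pred n {{>-nonZero (≤-trans (s≤s z≤n) 3≤n)}}

  last<n : last < n
  last<n = subst (last <_) suc-last ≤-refl

  1<last : 1 < last
  1<last = ≤-pred (subst (2 <_) (sym suc-last) 3≤n)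

  ¬Chord-suc : ∀ a → ¬ Chord a (suc a)
  ¬Chord-suc a c = Chord⇒¬consecutive c (from (T-∨ {suc a ≡ᵇ suc a}) (inj₁ (fromWitness refl)))

  ¬Chord-0-last : ¬ Chord 0 last
  ¬Chord-0-last c = Chord⇒¬consecutive c
    (from (T-∨ {suc 0 ≡ᵇ last}) (inj₂ (from (T-∨ {suc last ≡ᵇ 0}) (inj₂ (from (T-∨ {(0 ≡ᵇ 0) ∧ (suc last ≡ᵇ n)}) (inj₁ (from (T-∧ {0 ≡ᵇ 0}) (tt , fromWitness suc-last))))))))

  side-edge : ∀ a → suc a < n → Edge a (suc a)
  side-edge a 1+a<n with edge a (suc a) in e
  ... | true = tt
  ... | false = saturated (n<1+n a) 1+a<n (subst T e) (λ a<c c<1+a _ _ _ → <⇒≱ a<c (≤-pred c<1+a))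

  closing-edge : Edge 0 last
  closing-edge with edge 0 last in e
  ... | true = tt
  ... | false = saturated (<-trans (s≤s z≤n) 1<last) last<n (subst T e) nothing-outside
    where
    nothing-outside : ∀ {c d} → 0 < c → c < last → d < n → d < 0 ⊎ last < d → ¬ T (edge c d)
    nothing-outside _ _ d<n (inj₂ last<d) _ = <⇒≱ last<d (≤-pred (subst (_ <_) (sym suc-last) d<n))

  farthest-neighbour-below : ∀ {i j} → j < n → ∀ y → i < y → y < j → (∀ z → y < z → z < j → ¬ Edge i z) →
                             Σ ℕ λ k → i < k × k < j × Edge i k × (∀ z → k < z → z < j → ¬ Edge i z)
  farthest-neighbour-below {i} {j} j<n (suc y) i<y y<j above with edge i (suc y) in e
  ... | true = suc y , i<y , y<j , subst T (sym e) tt , above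
  ... | false with i Data.Nat.≟ y
  ...   | yes refl = ⊥-elim (subst T e (side-edge i (<-trans y<j j<n)))
  ...   | no i≢y = farthest-neighbour-below j<n y (≤∧≢⇒< (≤-pred i<y) i≢y) (<-trans (n<1+n y) y<j) above′
    where
    above′ : ∀ z → y < z → z < j → ¬ Edge i z
    above′ z y<z z<j iz with suc y Data.Nat.≟ z
    ... | yes refl = subst T e iz
    ... | no 1+y≢z = above z (≤∧≢⇒< y<z 1+y≢z) z<j iz

  -- The apex is the farthest neighbour k of i below j: an edge separating k from j would cross ij or ik,
  -- or be a farther neighbour of i, so saturation makes kj an edge.
  triangle-apex : ∀ {i j} → suc i < j → j < n → Edge i j →
                  Σ ℕ λ k → i < k × k < j × Edge i k × Edge k j
  triangle-apex {i} {j} 1+i<j j<n ij with farthest-neighbour-below j<n (pred j) i<j-1 j-1<j nothing-above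
    where
    1+j-1 : suc (pred j) ≡ j
    1+j-1 = suc-pred j {{>-nonZero (<-trans (s≤s z≤n) 1+i<j)}}
    i<j-1 : i < pred j
    i<j-1 = ≤-pred (subst (suc (suc i) ≤_) (sym 1+j-1) 1+i<j)
    j-1<j : pred j < j
    j-1<j = subst (pred j <_) 1+j-1 ≤-refl
    nothing-above : ∀ z → pred j < z → z < j → ¬ Edge i z
    nothing-above z j-1<z z<j _ = <⇒≱ j-1<z (≤-pred (subst (z <_) (sym 1+j-1) z<j))
  ... | k , i<k , k<j , ik , above = k , i<k , k<j , ik , kj
    where
    blocked : ∀ {c d} → k < c → c < j → d < n → d < k ⊎ j < d → ¬ Edge c d
    blocked k<c c<j _ (inj₂ j<d) cd = non-crossing (<-trans i<k k<c) c<j j<d ij cd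
    blocked {c} {d} k<c c<j _ (inj₁ d<k) cd with <-cmp d i
    ... | tri< d<i _ _ = non-crossing d<i (<-trans i<k k<c) c<j (Edge-sym cd) ij
    ... | tri≈ _ refl _ = above c k<c c<j (Edge-sym cd)
    ... | tri> _ _ i<d = non-crossing i<d d<k k<c ik (Edge-sym cd)
    kj : Edge k j
    kj with edge k j in e
    ... | true = tt
    ... | false = ⊥-elim (saturated k<j j<n (subst T e) blocked)

  record ChordSquare (a b c d : ℕ) : Set where
    field
      ab  : Chord a b
      bc  : Chord b c
      cd  : Chord c d
      da  : Chord d a
      a≢b : a ≢ b
      a≢c : a ≢ c
      a≢d : a ≢ d
      b≢c : b ≢ c
      b≢d : b ≢ d
      c≢d : c ≢ d
  open ChordSquare

  rotate : ∀ {a b c d} → ChordSquare a b c d → ChordSquare b c d a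
  rotate q = record { ab = bc q ; bc = cd q ; cd = da q ; da = ab q
                    ; a≢b = b≢c q ; a≢c = b≢d q ; a≢d = ≢-sym (a≢b q)
                    ; b≢c = c≢d q ; b≢d = ≢-sym (a≢c q) ; c≢d = ≢-sym (a≢d q) }

  reflect : ∀ {a b c d} → ChordSquare a b c d → ChordSquare b a d c
  reflect q = record { ab = Chord-sym (ab q) ; bc = Chord-sym (da q) ; cd = Chord-sym (cd q) ; da = Chord-sym (bc q)
                     ; a≢b = ≢-sym (a≢b q) ; a≢c = b≢d q ; a≢d = b≢c q
                     ; b≢c = a≢d q ; b≢d = a≢c q ; c≢d = ≢-sym (c≢d q) }

  All4 : (ℕ → Set) → ℕ → ℕ → ℕ → ℕ → Set
  All4 P a b c d = P a × P b × P c × P d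

  Within : ℕ → ℕ → ℕ → Set
  Within i j w = i ≤ w × w ≤ j

  OneOf4 : ℕ → ℕ → ℕ → ℕ → ℕ → Set
  OneOf4 a b c d w = w ≡ a ⊎ w ≡ b ⊎ w ≡ c ⊎ w ≡ d

  OnOneSide : ℕ → ℕ → ℕ → Set
  OnOneSide k x y = (x ≤ k × y ≤ k) ⊎ (k ≤ x × k ≤ y)

  LeftSquare RightSquare SquareSplit : ℕ → ℕ → ℕ → ℕ → ℕ → ℕ → ℕ → Set
  LeftSquare i k j a b c d =
    Σ ℕ λ p → i < p × p < k × Chord i p × Chord p k × Chord k j × Chord i j × All4 (OneOf4 i p k j) a b c d
  RightSquare i k j a b c d =
    Σ ℕ λ q → k < q × q < j × Chord i k × Chord k q × Chord q j × Chord i j × All4 (OneOf4 i k q j) a b c d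
  SquareSplit i k j a b c d =
    All4 (_≤ k) a b c d ⊎ All4 (k ≤_) a b c d ⊎ LeftSquare i k j a b c d ⊎ RightSquare i k j a b c d

  split-rotate : ∀ {i k j a b c d} → SquareSplit i k j b c d a → SquareSplit i k j a b c d
  split-rotate (inj₁ (pb , pc , pd , pa)) = inj₁ (pa , pb , pc , pd)
  split-rotate (inj₂ (inj₁ (pb , pc , pd , pa))) = inj₂ (inj₁ (pa , pb , pc , pd))
  split-rotate (inj₂ (inj₂ (inj₁ (p , h₁ , h₂ , h₃ , h₄ , h₅ , h₆ , (pb , pc , pd , pa))))) =
    inj₂ (inj₂ (inj₁ (p , h₁ , h₂ , h₃ , h₄ , h₅ , h₆ , (pa , pb , pc , pd))))
  split-rotate (inj₂ (inj₂ (inj₂ (q , h₁ , h₂ , h₃ , h₄ , h₅ , h₆ , (pb , pc , pd , pa))))) =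
    inj₂ (inj₂ (inj₂ (q , h₁ , h₂ , h₃ , h₄ , h₅ , h₆ , (pa , pb , pc , pd))))

  split-reflect : ∀ {i k j a b c d} → SquareSplit i k j b a d c → SquareSplit i k j a b c d
  split-reflect (inj₁ (pb , pa , pd , pc)) = inj₁ (pa , pb , pc , pd)
  split-reflect (inj₂ (inj₁ (pb , pa , pd , pc))) = inj₂ (inj₁ (pa , pb , pc , pd))
  split-reflect (inj₂ (inj₂ (inj₁ (p , h₁ , h₂ , h₃ , h₄ , h₅ , h₆ , (pb , pa , pd , pc))))) =
    inj₂ (inj₂ (inj₁ (p , h₁ , h₂ , h₃ , h₄ , h₅ , h₆ , (pa , pb , pc , pd))))
  split-reflect (inj₂ (inj₂ (inj₂ (q , h₁ , h₂ , h₃ , h₄ , h₅ , h₆ , (pb , pa , pd , pc))))) =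
    inj₂ (inj₂ (inj₂ (q , h₁ , h₂ , h₃ , h₄ , h₅ , h₆ , (pa , pb , pc , pd))))

  private
    both-at : ∀ {k x y} → x ≤ k → k ≤ x → y ≤ k → k ≤ y → x ≢ y → ⊥
    both-at x≤k k≤x y≤k k≤y x≢y = x≢y (trans (≤-antisym x≤k k≤x) (≤-antisym k≤y y≤k))

  square-on-one-side : ∀ {k a b c d} → ChordSquare a b c d → OnOneSide k a b → OnOneSide k b c → OnOneSide k c d → OnOneSide k d a →
           All4 (_≤ k) a b c d ⊎ All4 (k ≤_) a b c d
  square-on-one-side q (inj₁ (a1 , b1)) (inj₁ (b2 , c1)) (inj₁ (c2 , d1)) (inj₁ (d2 , a2)) = inj₁ (a1 , b1 , c1 , d1)
  square-on-one-side q (inj₂ (a1 , b1)) (inj₂ (b2 , c1)) (inj₂ (c2 , d1)) (inj₂ (d2 , a2)) = inj₂ (a1 , b1 , c1 , d1)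
  square-on-one-side q (inj₁ (a1 , b1)) (inj₁ (b2 , c1)) (inj₁ (c2 , d1)) (inj₂ (d2 , a2)) = ⊥-elim (both-at d1 d2 a1 a2 (≢-sym (a≢d q)))
  square-on-one-side q (inj₁ (a1 , b1)) (inj₁ (b2 , c1)) (inj₂ (c2 , d1)) (inj₁ (d2 , a2)) = ⊥-elim (both-at c1 c2 d2 d1 (c≢d q))
  square-on-one-side q (inj₁ (a1 , b1)) (inj₁ (b2 , c1)) (inj₂ (c2 , d1)) (inj₂ (d2 , a2)) = ⊥-elim (both-at c1 c2 a1 a2 (≢-sym (a≢c q)))
  square-on-one-side q (inj₁ (a1 , b1)) (inj₂ (b2 , c1)) (inj₁ (c2 , d1)) (inj₁ (d2 , a2)) = ⊥-elim (both-at b1 b2 c2 c1 (b≢c q))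
  square-on-one-side q (inj₁ (a1 , b1)) (inj₂ (b2 , c1)) (inj₁ (c2 , d1)) (inj₂ (d2 , a2)) = ⊥-elim (both-at b1 b2 c2 c1 (b≢c q))
  square-on-one-side q (inj₁ (a1 , b1)) (inj₂ (b2 , c1)) (inj₂ (c2 , d1)) (inj₁ (d2 , a2)) = ⊥-elim (both-at b1 b2 d2 d1 (b≢d q))
  square-on-one-side q (inj₁ (a1 , b1)) (inj₂ (b2 , c1)) (inj₂ (c2 , d1)) (inj₂ (d2 , a2)) = ⊥-elim (both-at b1 b2 a1 a2 (≢-sym (a≢b q)))
  square-on-one-side q (inj₂ (a1 , b1)) (inj₁ (b2 , c1)) (inj₁ (c2 , d1)) (inj₁ (d2 , a2)) = ⊥-elim (both-at b2 b1 a2 a1 (≢-sym (a≢b q)))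
  square-on-one-side q (inj₂ (a1 , b1)) (inj₁ (b2 , c1)) (inj₁ (c2 , d1)) (inj₂ (d2 , a2)) = ⊥-elim (both-at b2 b1 d1 d2 (b≢d q))
  square-on-one-side q (inj₂ (a1 , b1)) (inj₁ (b2 , c1)) (inj₂ (c2 , d1)) (inj₁ (d2 , a2)) = ⊥-elim (both-at b2 b1 c1 c2 (b≢c q))
  square-on-one-side q (inj₂ (a1 , b1)) (inj₁ (b2 , c1)) (inj₂ (c2 , d1)) (inj₂ (d2 , a2)) = ⊥-elim (both-at b2 b1 c1 c2 (b≢c q))
  square-on-one-side q (inj₂ (a1 , b1)) (inj₂ (b2 , c1)) (inj₁ (c2 , d1)) (inj₁ (d2 , a2)) = ⊥-elim (both-at c2 c1 a2 a1 (≢-sym (a≢c q)))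
  square-on-one-side q (inj₂ (a1 , b1)) (inj₂ (b2 , c1)) (inj₁ (c2 , d1)) (inj₂ (d2 , a2)) = ⊥-elim (both-at c2 c1 d1 d2 (c≢d q))
  square-on-one-side q (inj₂ (a1 , b1)) (inj₂ (b2 , c1)) (inj₂ (c2 , d1)) (inj₁ (d2 , a2)) = ⊥-elim (both-at d2 d1 a2 a1 (≢-sym (a≢d q)))

  OnSquareWithin : ℕ → ℕ → ℕ → Set
  OnSquareWithin i j x = Σ ℕ λ a → Σ ℕ λ b → Σ ℕ λ c → ChordSquare x a b c × All4 (Within i j) x a b c

  private
    SquareData : ℕ → ℕ → ℕ → ℕ → ℕ → ℕ → Set
    SquareData i j x a b c =
      All4 (Within i j) x a b c × (Chord x a × Chord a b × Chord b c × Chord c x) ×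
      (x ≢ a × x ≢ b × x ≢ c × a ≢ b × a ≢ c × b ≢ c)

    squareData? : ∀ i j x a b c → Dec (SquareData i j x a b c)
    squareData? i j x a b c =
      (within? x ×-dec (within? a ×-dec (within? b ×-dec within? c))) ×-dec
      ((chord? x a ×-dec (chord? a b ×-dec (chord? b c ×-dec chord? c x))) ×-dec
      (≢? x a ×-dec (≢? x b ×-dec (≢? x c ×-dec (≢? a b ×-dec (≢? a c ×-dec ≢? b c))))))
      where
      within? : ∀ w → Dec (Within i j w)
      within? w = (i ≤? w) ×-dec (w ≤? j)
      chord? : ∀ u v → Dec (Chord u v)
      chord? u v = T? (chord u v)
      ≢? : ∀ (u v : ℕ) → Dec (u ≢ v)
      ≢? u v = ¬? (u Data.Nat.≟ v)

  opaque
    inSquare : ℕ → ℕ → ℕ → Bool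
    inSquare i j x = anyBelow (λ a → anyBelow (λ b → anyBelow (λ c → ⌊ squareData? i j x a b c ⌋) n) n) n

  opaque
    unfolding inSquare

    inSquare-sound : ∀ {i j x} → T (inSquare i j x) → OnSquareWithin i j x
    inSquare-sound {i} {j} {x} t with anyBelow-sound _ n t
    ... | a , _ , t₁ with anyBelow-sound _ n t₁
    ... | b , _ , t₂ with anyBelow-sound _ n t₂
    ... | c , _ , t₃ with toWitness {a? = squareData? i j x a b c} t₃
    ... | within , (xa , ab′ , bc′ , cx) , (x≢a , x≢b , x≢c , a≢b′ , a≢c′ , b≢c′) =
      a , b , c ,
      record { ab = xa ; bc = ab′ ; cd = bc′ ; da = cx
             ; a≢b = x≢a ; a≢c = x≢b ; a≢d = x≢c ; b≢c = a≢b′ ; b≢d = a≢c′ ; c≢d = b≢c′ } ,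
      within

    inSquare-complete : ∀ {i j x} → OnSquareWithin i j x → T (inSquare i j x)
    inSquare-complete {i} {j} {x} (a , b , c , q , within) =
      anyBelow-complete _ n a (edge-bounded _ _ (Chord⇒Edge (ab q)))
        (anyBelow-complete _ n b (edge-bounded _ _ (Chord⇒Edge (bc q)))
          (anyBelow-complete _ n c (edge-bounded _ _ (Chord⇒Edge (cd q)))
            (fromWitness {a? = squareData? i j x a b c}
              (within , (ab q , bc q , cd q , da q) , (a≢b q , a≢c q , a≢d q , b≢c q , b≢d q , c≢d q)))))

  ChordApex : ℕ → ℕ → ℕ → Set
  ChordApex i j y = i < y × y < j × Chord y i × Chord y j

  private
    chordApex? : ∀ i j y → Dec (ChordApex i j y)
    chordApex? i j y = (i <? y) ×-dec ((y <? j) ×-dec (T? (chord y i) ×-dec T? (chord y j)))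

  opaque
    hasChordApex : ℕ → ℕ → Bool
    hasChordApex i j = anyBelow (λ y → ⌊ chordApex? i j y ⌋) n

  opaque
    unfolding hasChordApex

    hasChordApex-complete : ∀ {i j y} → ChordApex i j y → T (hasChordApex i j)
    hasChordApex-complete {i} {j} {y} apex@(_ , _ , yi , _) =
      anyBelow-complete _ n y (Edge⇒<n (Chord⇒Edge yi)) (fromWitness {a? = chordApex? i j y} apex)

    hasChordApex-sound : ∀ {i j} → T (hasChordApex i j) → Σ ℕ (ChordApex i j)
    hasChordApex-sound {i} {j} t with anyBelow-sound _ n t
    ... | y , _ , t′ = y , toWitness {a? = chordApex? i j y} t′

  chordless : ℕ → Bool
  chordless x = not (anyBelow (chord x) n)

  chordless-intro : ∀ {x} → (∀ y → ¬ Chord x y) → T (chordless x)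
  chordless-intro {x} none with anyBelow (chord x) n in e
  ... | true = let (y , _ , xy) = anyBelow-sound (chord x) n (subst T (sym e) tt) in none y xy
  ... | false = tt

  chordless-elim : ∀ {x y} → T (chordless x) → ¬ Chord x y
  chordless-elim {x} {y} t xy with anyBelow (chord x) n in e
  ... | false = subst T e (anyBelow-complete (chord x) n y (edge-bounded _ _ (Chord⇒Edge xy)) xy)

  -- The only chord 4-cycles in [i, j] using both sides of the triangle i k j: i p k j and i k q j.
  leftSquare rightSquare : ℕ → ℕ → ℕ → Bool
  leftSquare i k j = (chord i j ∧ chord k j) ∧ hasChordApex i k
  rightSquare i k j = (chord i j ∧ chord i k) ∧ hasChordApex k j

  squareAcross : ℕ → ℕ → ℕ → Bool
  squareAcross i k j = leftSquare i k j ∨ rightSquare i k j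

  inSquareOrApex : Bool → ℕ → ℕ → ℕ → Bool
  inSquareOrApex e i j x = inSquare i j x ∨ (e ∧ (chord x i ∧ chord x j))

  earsInside squaresInside : ℕ → ℕ → ℕ
  earsInside i j = count chordless (suc i) j
  squaresInside i j = count (inSquare i j) (suc i) j

  count-inSquareOrApex : ∀ e i j → count (inSquareOrApex e i j) (suc i) j ≤ squaresInside i j + bit (e ∧ hasChordApex i j)
  count-inSquareOrApex e i j =
    ≤-trans (count-∨ (inSquare i j) apexWith (suc i) j)
            (+-monoʳ-≤ (squaresInside i j) (count-atMostOne apexWith (e ∧ hasChordApex i j) (suc i) j unique witness))
    where
    apexWith : ℕ → Bool
    apexWith x = e ∧ (chord x i ∧ chord x j)
    chords : ∀ {x} → T (apexWith x) → Chord x i × Chord x j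
    chords {x} t = to T-∧ (proj₂ (to (T-∧ {e}) t))
    unique : ∀ x y → suc i ≤ x → x < j → suc i ≤ y → y < j → T (apexWith x) → T (apexWith y) → x ≡ y
    unique x y i<x x<j i<y y<j tx ty with <-cmp x y
    ... | tri≈ _ x≡y _ = x≡y
    ... | tri< x<y _ _ = ⊥-elim (non-crossing i<x x<y y<j (Chord⇒Edge (Chord-sym (proj₁ (chords ty)))) (Chord⇒Edge (proj₂ (chords tx))))
    ... | tri> _ _ y<x = ⊥-elim (non-crossing i<y y<x x<j (Chord⇒Edge (Chord-sym (proj₁ (chords tx)))) (Chord⇒Edge (proj₂ (chords ty))))
    witness : ∀ x → suc i ≤ x → x < j → T (apexWith x) → T (e ∧ hasChordApex i j)
    witness x i<x x<j t = from T-∧ (proj₁ (to (T-∧ {e}) t) , hasChordApex-complete (i<x , x<j , chords t))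

  ¬inSquare-side : ∀ {i x} → ¬ T (inSquare i (suc i) x)
  ¬inSquare-side {i} t with inSquare-sound t
  ... | _ , _ , _ , q , (wx , wa , wb , _) with endpoint wx | endpoint wa | endpoint wb
    where
    endpoint : ∀ {w} → Within i (suc i) w → w ≡ i ⊎ w ≡ suc i
    endpoint (i≤w , w≤1+i) with m≤n⇒m<n∨m≡n w≤1+i
    ... | inj₁ w<1+i = inj₁ (≤-antisym (≤-pred w<1+i) i≤w)
    ... | inj₂ w≡1+i = inj₂ w≡1+i
  ... | inj₁ x≡ | inj₁ a≡ | _ = a≢b q (trans x≡ (sym a≡))
  ... | inj₂ x≡ | inj₂ a≡ | _ = a≢b q (trans x≡ (sym a≡))
  ... | inj₁ x≡ | _ | inj₁ b≡ = a≢c q (trans x≡ (sym b≡))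
  ... | inj₂ x≡ | _ | inj₂ b≡ = a≢c q (trans x≡ (sym b≡))
  ... | inj₁ _ | inj₂ a≡ | inj₂ b≡ = b≢c q (trans a≡ (sym b≡))
  ... | inj₂ _ | inj₁ a≡ | inj₁ b≡ = b≢c q (trans a≡ (sym b≡))

  ¬hasChordApex-side : ∀ {i} → ¬ T (hasChordApex i (suc i))
  ¬hasChordApex-side t with hasChordApex-sound t
  ... | _ , i<y , y<1+i , _ = <⇒≱ i<y (≤-pred y<1+i)

  leftSquare⇒hasChordApex : ∀ {i k j} → T (leftSquare i k j) → T (hasChordApex i k)
  leftSquare⇒hasChordApex {i} {k} {j} t = proj₂ (to (T-∧ {chord i j ∧ chord k j}) t)

  rightSquare⇒hasChordApex : ∀ {i k j} → T (rightSquare i k j) → T (hasChordApex k j)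
  rightSquare⇒hasChordApex {i} {k} {j} t = proj₂ (to (T-∧ {chord i j ∧ chord i k}) t)

  leftSquare⇒Chords : ∀ {i k j} → T (leftSquare i k j) → Chord i j × Chord k j
  leftSquare⇒Chords {i} {k} {j} t = to (T-∧ {chord i j}) (proj₁ (to (T-∧ {chord i j ∧ chord k j}) t))

  rightSquare⇒Chords : ∀ {i k j} → T (rightSquare i k j) → Chord i j × Chord i k
  rightSquare⇒Chords {i} {k} {j} t = to (T-∧ {chord i j}) (proj₁ (to (T-∧ {chord i j ∧ chord i k}) t))

  ¬squareAcross-over-side : ∀ {i k j} → ¬ Chord i j → ¬ T (squareAcross i k j)
  ¬squareAcross-over-side {i} {k} {j} ¬ij t with to (T-∨ {leftSquare i k j}) t
  ... | inj₁ left = ¬ij (proj₁ (leftSquare⇒Chords left))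
  ... | inj₂ right = ¬ij (proj₁ (rightSquare⇒Chords right))

  ¬squareAcross-left-side : ∀ {i j} → ¬ T (squareAcross i (suc i) j)
  ¬squareAcross-left-side {i} {j} t with to (T-∨ {leftSquare i (suc i) j}) t
  ... | inj₁ left = ¬hasChordApex-side (leftSquare⇒hasChordApex left)
  ... | inj₂ right = ¬Chord-suc i (proj₂ (rightSquare⇒Chords right))

  ¬squareAcross-right-side : ∀ {i k} → ¬ T (squareAcross i k (suc k))
  ¬squareAcross-right-side {i} {k} t with to (T-∨ {leftSquare i k (suc k)}) t
  ... | inj₁ left = ¬Chord-suc k (proj₂ (leftSquare⇒Chords left))
  ... | inj₂ right = ¬hasChordApex-side (rightSquare⇒hasChordApex right)

  ear-of-triangle : ∀ {i} → Edge i (suc (suc i)) → T (chordless (suc i))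
  ear-of-triangle {i} i-2+i = chordless-intro no-chord
    where
    no-chord : ∀ y → ¬ Chord (suc i) y
    no-chord y c with <-cmp y (suc i)
    ... | tri≈ _ refl _ = edge-irrefl y (Chord⇒Edge c)
    ... | tri< y<1+i _ _ with m≤n⇒m<n∨m≡n (≤-pred y<1+i)
    ...   | inj₁ y<i = non-crossing y<i ≤-refl ≤-refl (Chord⇒Edge (Chord-sym c)) i-2+i
    ...   | inj₂ refl = ¬Chord-suc y (Chord-sym c)
    no-chord y c | tri> _ _ 1+i<y with m≤n⇒m<n∨m≡n 1+i<y
    ...   | inj₁ 2+i<y = non-crossing ≤-refl ≤-refl 2+i<y i-2+i (Chord⇒Edge c)
    ...   | inj₂ refl = ¬Chord-suc (suc i) c


  module Fan {i k j : ℕ} (i<k : i < k) (k<j : k < j) (ik : Edge i k) (kj : Edge k j) where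

    edge-split< : ∀ {x y} → i ≤ x → y ≤ j → x < y → Edge x y → y ≤ k ⊎ k ≤ x ⊎ (x ≡ i × y ≡ j)
    edge-split< {x} {y} i≤x y≤j x<y xy with y ≤? k | k ≤? x
    ... | yes y≤k | _ = inj₁ y≤k
    ... | no _ | yes k≤x = inj₂ (inj₁ k≤x)
    ... | no y≰k | no k≰x with m≤n⇒m<n∨m≡n i≤x | m≤n⇒m<n∨m≡n y≤j
    ...   | inj₁ i<x | _ = ⊥-elim (non-crossing i<x (≰⇒> k≰x) (≰⇒> y≰k) ik xy)
    ...   | inj₂ refl | inj₁ y<j = ⊥-elim (non-crossing i<k (≰⇒> y≰k) y<j xy kj)
    ...   | inj₂ refl | inj₂ refl = inj₂ (inj₂ (refl , refl))

    edge-split : ∀ {x y} → Within i j x → Within i j y → Edge x y → OnOneSide k x y ⊎ IsPair i j x y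
    edge-split {x} {y} (i≤x , x≤j) (i≤y , y≤j) xy with <-cmp x y
    ... | tri≈ _ refl _ = ⊥-elim (edge-irrefl x xy)
    ... | tri< x<y _ _ with edge-split< i≤x y≤j x<y xy
    ...   | inj₁ y≤k = inj₁ (inj₁ (≤-trans (<⇒≤ x<y) y≤k , y≤k))
    ...   | inj₂ (inj₁ k≤x) = inj₁ (inj₂ (k≤x , ≤-trans k≤x (<⇒≤ x<y)))
    ...   | inj₂ (inj₂ pair) = inj₂ (inj₁ pair)
    edge-split {x} {y} (i≤x , x≤j) (i≤y , y≤j) xy | tri> _ _ y<x with edge-split< i≤y x≤j y<x (Edge-sym xy)
    ...   | inj₁ x≤k = inj₁ (inj₁ (x≤k , ≤-trans (<⇒≤ y<x) x≤k))
    ...   | inj₂ (inj₁ k≤y) = inj₁ (inj₂ (≤-trans k≤y (<⇒≤ y<x) , k≤y))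
    ...   | inj₂ (inj₂ (y≡i , x≡j)) = inj₂ (inj₂ (x≡j , y≡i))

    private
      i≤j = <⇒≤ (<-trans i<k k<j)

    square-split-on-base : ∀ {c d} → ChordSquare i j c d → Within i j c → Within i j d → SquareSplit i k j i j c d
    square-split-on-base {c} {d} q wc@(i≤c , c≤j) wd@(i≤d , d≤j) = split
      where
      d≤k : d ≤ k
      d≤k with edge-split wd (≤-refl , i≤j) (Chord⇒Edge (da q))
      ... | inj₁ (inj₁ (d≤k , _)) = d≤k
      ... | inj₁ (inj₂ (_ , k≤i)) = ⊥-elim (<⇒≱ i<k k≤i)
      ... | inj₂ (inj₁ (d≡i , _)) = ⊥-elim (a≢d q (sym d≡i))
      ... | inj₂ (inj₂ (d≡j , _)) = ⊥-elim (b≢d q (sym d≡j))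
      k≤c : k ≤ c
      k≤c with edge-split (i≤j , ≤-refl) wc (Chord⇒Edge (bc q))
      ... | inj₁ (inj₁ (j≤k , _)) = ⊥-elim (<⇒≱ k<j j≤k)
      ... | inj₁ (inj₂ (_ , k≤c)) = k≤c
      ... | inj₂ (inj₁ (j≡i , _)) = ⊥-elim (a≢b q (sym j≡i))
      ... | inj₂ (inj₂ (_ , c≡i)) = ⊥-elim (a≢c q (sym c≡i))
      split : SquareSplit i k j i j c d
      split with edge-split wc wd (Chord⇒Edge (cd q))
      ... | inj₂ (inj₁ (c≡i , _)) = ⊥-elim (a≢c q (sym c≡i))
      ... | inj₂ (inj₂ (c≡j , _)) = ⊥-elim (b≢c q (sym c≡j))
      ... | inj₁ (inj₁ (c≤k , _)) with ≤-antisym c≤k k≤c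
      ...   | refl = inj₂ (inj₂ (inj₁ (d , ≤∧≢⇒< i≤d (a≢d q) , ≤∧≢⇒< d≤k (≢-sym (c≢d q)) ,
                       Chord-sym (da q) , Chord-sym (cd q) , Chord-sym (bc q) , ab q ,
                       inj₁ refl , inj₂ (inj₂ (inj₂ refl)) , inj₂ (inj₂ (inj₁ refl)) , inj₂ (inj₁ refl))))
      split | inj₁ (inj₂ (_ , k≤d)) with ≤-antisym d≤k k≤d
      ...   | refl = inj₂ (inj₂ (inj₂ (c , ≤∧≢⇒< k≤c (c≢d q ∘ sym) , ≤∧≢⇒< c≤j (≢-sym (b≢c q)) ,
                       Chord-sym (da q) , Chord-sym (cd q) , Chord-sym (bc q) , ab q ,
                       inj₁ refl , inj₂ (inj₂ (inj₂ refl)) , inj₂ (inj₂ (inj₁ refl)) , inj₂ (inj₁ refl))))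

    square-split : ∀ {a b c d} → ChordSquare a b c d → All4 (Within i j) a b c d → SquareSplit i k j a b c d
    square-split {a} {b} {c} {d} q (wa , wb , wc , wd) = classify-ab
      where
      classify : ∀ {x y} → Within i j x → Within i j y → Chord x y → OnOneSide k x y ⊎ IsPair i j x y
      classify wx wy xy = edge-split wx wy (Chord⇒Edge xy)
      classify-da : OnOneSide k a b → OnOneSide k b c → OnOneSide k c d → SquareSplit i k j a b c d
      classify-da s-ab s-bc s-cd with classify wd wa (da q)
      ... | inj₁ s-da = [ inj₁ , inj₂ ∘ inj₁ ]′ (square-on-one-side q s-ab s-bc s-cd s-da)
      ... | inj₂ (inj₁ (refl , refl)) = split-rotate (split-rotate (split-rotate (square-split-on-base (rotate (rotate (rotate q))) wb wc)))
      ... | inj₂ (inj₂ (refl , refl)) = split-rotate (split-rotate (split-rotate (split-reflect (square-split-on-base (reflect (rotate (rotate (rotate q)))) wc wb))))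
      classify-cd : OnOneSide k a b → OnOneSide k b c → SquareSplit i k j a b c d
      classify-cd s-ab s-bc with classify wc wd (cd q)
      ... | inj₁ s-cd = classify-da s-ab s-bc s-cd
      ... | inj₂ (inj₁ (refl , refl)) = split-rotate (split-rotate (square-split-on-base (rotate (rotate q)) wa wb))
      ... | inj₂ (inj₂ (refl , refl)) = split-rotate (split-rotate (split-reflect (square-split-on-base (reflect (rotate (rotate q))) wb wa)))
      classify-bc : OnOneSide k a b → SquareSplit i k j a b c d
      classify-bc s-ab with classify wb wc (bc q)
      ... | inj₁ s-bc = classify-cd s-ab s-bc
      ... | inj₂ (inj₁ (refl , refl)) = split-rotate (square-split-on-base (rotate q) wd wa)
      ... | inj₂ (inj₂ (refl , refl)) = split-rotate (split-reflect (square-split-on-base (reflect (rotate q)) wa wd))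
      classify-ab : SquareSplit i k j a b c d
      classify-ab with classify wa wb (ab q)
      ... | inj₁ s-ab = classify-bc s-ab
      ... | inj₂ (inj₁ (refl , refl)) = square-split-on-base q wc wd
      ... | inj₂ (inj₂ (refl , refl)) = split-reflect (square-split-on-base (reflect q) wd wc)

    private
      split-at : ∀ {x} → T (inSquare i j x) →
                 Σ ℕ λ a → Σ ℕ λ b → Σ ℕ λ c → ChordSquare x a b c × All4 (Within i j) x a b c × SquareSplit i k j x a b c
      split-at t = let (a , b , c , q , w) = inSquare-sound t in a , b , c , q , w , square-split q w

      left-part : ∀ {a b c d} → ChordSquare a b c d → All4 (Within i j) a b c d → All4 (_≤ k) a b c d → T (inSquare i k a)
      left-part q (wa , wb , wc , wd) (a≤ , b≤ , c≤ , d≤) =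
        inSquare-complete (_ , _ , _ , q , (proj₁ wa , a≤) , (proj₁ wb , b≤) , (proj₁ wc , c≤) , (proj₁ wd , d≤))

      right-part : ∀ {a b c d} → ChordSquare a b c d → All4 (Within i j) a b c d → All4 (k ≤_) a b c d → T (inSquare k j a)
      right-part q (wa , wb , wc , wd) (≤a , ≤b , ≤c , ≤d) =
        inSquare-complete (_ , _ , _ , q , (≤a , proj₂ wa) , (≤b , proj₂ wb) , (≤c , proj₂ wc) , (≤d , proj₂ wd))

      isLeftSquare : ∀ {p} → i < p → p < k → Chord i p → Chord p k → Chord k j → Chord i j → T (leftSquare i k j)
      isLeftSquare i<p p<k ip pk kj′ ij = from T-∧ (from T-∧ (ij , kj′) , hasChordApex-complete (i<p , p<k , Chord-sym ip , pk))

      isRightSquare : ∀ {q} → k < q → q < j → Chord i k → Chord k q → Chord q j → Chord i j → T (rightSquare i k j)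
      isRightSquare k<q q<j ik′ kq qj ij = from T-∧ (from T-∧ (ij , ik′) , hasChordApex-complete (k<q , q<j , Chord-sym kq , qj))

      left-or-right : ∀ {a b c d} → LeftSquare i k j a b c d ⊎ RightSquare i k j a b c d →
                      T (squareAcross i k j)
      left-or-right (inj₁ (_ , i<p , p<k , ip , pk , kj′ , ij , _)) = from T-∨ (inj₁ (isLeftSquare i<p p<k ip pk kj′ ij))
      left-or-right (inj₂ (_ , k<q , q<j , ik′ , kq , qj , ij , _)) = from T-∨ (inj₂ (isRightSquare k<q q<j ik′ kq qj ij))

    inSquare-left-interior : ∀ {x} → i < x → x < k → T (inSquare i j x) →
                             T (inSquareOrApex (chord i j ∧ chord k j) i k x)
    inSquare-left-interior {x} i<x x<k t with split-at t
    ... | _ , _ , _ , q , w , inj₁ below = from T-∨ (inj₁ (left-part q w below))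
    ... | _ , _ , _ , _ , _ , inj₂ (inj₁ (k≤x , _)) = ⊥-elim (<⇒≱ x<k k≤x)
    ... | _ , _ , _ , _ , _ , inj₂ (inj₂ (inj₁ (p , _ , _ , ip , pk , kj′ , ij , x∈ , _))) with x∈
    ...   | inj₁ refl = ⊥-elim (<-irrefl refl i<x)
    ...   | inj₂ (inj₁ refl) = from T-∨ (inj₂ (from T-∧ (from T-∧ (ij , kj′) , from T-∧ (Chord-sym ip , pk))))
    ...   | inj₂ (inj₂ (inj₁ refl)) = ⊥-elim (<-irrefl refl x<k)
    ...   | inj₂ (inj₂ (inj₂ refl)) = ⊥-elim (<-asym x<k k<j)
    inSquare-left-interior {x} i<x x<k t | _ , _ , _ , _ , _ , inj₂ (inj₂ (inj₂ (q , k<q , _ , _ , _ , _ , _ , x∈ , _))) with x∈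
    ...   | inj₁ refl = ⊥-elim (<-irrefl refl i<x)
    ...   | inj₂ (inj₁ refl) = ⊥-elim (<-irrefl refl x<k)
    ...   | inj₂ (inj₂ (inj₁ refl)) = ⊥-elim (<-asym x<k k<q)
    ...   | inj₂ (inj₂ (inj₂ refl)) = ⊥-elim (<-asym x<k k<j)

    inSquare-right-interior : ∀ {x} → k < x → x < j → T (inSquare i j x) →
                              T (inSquareOrApex (chord i j ∧ chord i k) k j x)
    inSquare-right-interior {x} k<x x<j t with split-at t
    ... | _ , _ , _ , _ , _ , inj₁ (x≤k , _) = ⊥-elim (<⇒≱ k<x x≤k)
    ... | _ , _ , _ , q , w , inj₂ (inj₁ above) = from T-∨ (inj₁ (right-part q w above))
    ... | _ , _ , _ , _ , _ , inj₂ (inj₂ (inj₁ (p , _ , p<k , _ , _ , _ , _ , x∈ , _))) with x∈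
    ...   | inj₁ refl = ⊥-elim (<-asym i<k k<x)
    ...   | inj₂ (inj₁ refl) = ⊥-elim (<-asym p<k k<x)
    ...   | inj₂ (inj₂ (inj₁ refl)) = ⊥-elim (<-irrefl refl k<x)
    ...   | inj₂ (inj₂ (inj₂ refl)) = ⊥-elim (<-irrefl refl x<j)
    inSquare-right-interior {x} k<x x<j t | _ , _ , _ , _ , _ , inj₂ (inj₂ (inj₂ (q , _ , _ , ik′ , kq , qj , ij , x∈ , _))) with x∈
    ...   | inj₁ refl = ⊥-elim (<-asym i<k k<x)
    ...   | inj₂ (inj₁ refl) = ⊥-elim (<-irrefl refl k<x)
    ...   | inj₂ (inj₂ (inj₁ refl)) = from T-∨ (inj₂ (from T-∧ (from T-∧ (ij , ik′) , from T-∧ (Chord-sym kq , qj))))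
    ...   | inj₂ (inj₂ (inj₂ refl)) = ⊥-elim (<-irrefl refl x<j)

    inSquare-apex : T (inSquare i j k) →
                    T (inSquare i k k ∨ inSquare k j k ∨ squareAcross i k j)
    inSquare-apex t with split-at t
    ... | _ , _ , _ , q , w , inj₁ below = from T-∨ (inj₁ (left-part q w below))
    ... | _ , _ , _ , q , w , inj₂ (inj₁ above) = from (T-∨ {inSquare i k k}) (inj₂ (from T-∨ (inj₁ (right-part q w above))))
    ... | _ , _ , _ , _ , _ , inj₂ (inj₂ square) =
      from (T-∨ {inSquare i k k}) (inj₂ (from (T-∨ {inSquare k j k}) (inj₂ (left-or-right square))))

    inSquare-start : T (inSquare i j i) → T (inSquare i k i ∨ squareAcross i k j)
    inSquare-start t with split-at t
    ... | _ , _ , _ , q , w , inj₁ below = from T-∨ (inj₁ (left-part q w below))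
    ... | _ , _ , _ , _ , _ , inj₂ (inj₁ (k≤i , _)) = ⊥-elim (<⇒≱ i<k k≤i)
    ... | _ , _ , _ , _ , _ , inj₂ (inj₂ square) = from (T-∨ {inSquare i k i}) (inj₂ (left-or-right square))

    inSquare-end : T (inSquare i j j) → T (inSquare k j j ∨ squareAcross i k j)
    inSquare-end t with split-at t
    ... | _ , _ , _ , _ , _ , inj₁ (j≤k , _) = ⊥-elim (<⇒≱ k<j j≤k)
    ... | _ , _ , _ , q , w , inj₂ (inj₁ above) = from T-∨ (inj₁ (right-part q w above))
    ... | _ , _ , _ , _ , _ , inj₂ (inj₂ square) = from (T-∨ {inSquare k j j}) (inj₂ (left-or-right square))

    earsInside-split : earsInside i j ≡ earsInside i k + (bit (chordless k) + earsInside k j)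
    earsInside-split = count-cut chordless i<k k<j

    squaresInside-split : squaresInside i j ≤
      (squaresInside i k + bit (leftSquare i k j)) + (bit (inSquare i j k) + (squaresInside k j + bit (rightSquare i k j)))
    squaresInside-split = begin
        squaresInside i j
      ≡⟨ count-cut (inSquare i j) i<k k<j ⟩
        count (inSquare i j) (suc i) k + (bit (inSquare i j k) + count (inSquare i j) (suc k) j)
      ≤⟨ +-mono-≤ left (+-monoʳ-≤ (bit (inSquare i j k)) right) ⟩
        (squaresInside i k + bit (leftSquare i k j)) + (bit (inSquare i j k) + (squaresInside k j + bit (rightSquare i k j))) ∎
      where
      open ≤-Reasoning
      left : count (inSquare i j) (suc i) k ≤ squaresInside i k + bit (leftSquare i k j)
      left = ≤-trans (count-mono (inSquare i j) _ (suc i) k (λ _ i<x x<k → inSquare-left-interior i<x x<k))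
                     (count-inSquareOrApex (chord i j ∧ chord k j) i k)
      right : count (inSquare i j) (suc k) j ≤ squaresInside k j + bit (rightSquare i k j)
      right = ≤-trans (count-mono (inSquare i j) _ (suc k) j (λ _ k<x x<j → inSquare-right-interior k<x x<j))
                      (count-inSquareOrApex (chord i j ∧ chord i k) k j)

    chordApex-is-apex : ∀ {y} → ChordApex i j y → y ≡ k
    chordApex-is-apex {y} (i<y , y<j , yi , yj) with <-cmp y k
    ... | tri≈ _ y≡k _ = y≡k
    ... | tri< y<k _ _ = ⊥-elim (non-crossing i<y y<k k<j ik (Chord⇒Edge yj))
    ... | tri> _ _ k<y = ⊥-elim (non-crossing i<k k<y y<j (Chord⇒Edge (Chord-sym yi)) kj)

    ¬hasChordApex-of-side : ¬ Chord i k ⊎ ¬ Chord k j → ¬ T (hasChordApex i j)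
    ¬hasChordApex-of-side side t with hasChordApex-sound t
    ... | y , apex@(_ , _ , yi , yj) with chordApex-is-apex apex
    ... | refl = [ (λ ¬ik → ¬ik (Chord-sym yi)) , (λ ¬kj → ¬kj yj) ]′ side

    earsInside-sides≤ : earsInside i k + earsInside k j ≤ earsInside i j
    earsInside-sides≤ = ≤-trans (+-monoʳ-≤ (earsInside i k) (m≤n+m (earsInside k j) (bit (chordless k))))
                                (≤-reflexive (sym earsInside-split))

    earsInside-left≤ : earsInside i k ≤ earsInside i j
    earsInside-left≤ = ≤-trans (m≤m+n (earsInside i k) (earsInside k j)) earsInside-sides≤

    earsInside-right≤ : earsInside k j ≤ earsInside i j
    earsInside-right≤ = ≤-trans (m≤n+m (earsInside k j) (earsInside i k)) earsInside-sides≤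

    apex-ear≤ : bit (chordless k) ≤ earsInside i j
    apex-ear≤ = ≤-trans (≤-trans (m≤m+n _ (earsInside k j)) (m≤n+m _ (earsInside i k))) (≤-reflexive (sym earsInside-split))

    module NoSquareAcross (¬across : ¬ T (squareAcross i k j)) where

      squaresInside-split′ : squaresInside i j ≤ squaresInside i k + (bit (inSquare i j k) + squaresInside k j)
      squaresInside-split′ = drop-flags {A = squaresInside i k} {s = bit (inSquare i j k)} {B = squaresInside k j} squaresInside-split
        (bit-¬T (λ t → ¬across (from (T-∨ {leftSquare i k j}) (inj₁ t))))
        (bit-¬T (λ t → ¬across (from (T-∨ {leftSquare i k j}) (inj₂ t))))

      apex-vertex : T (inSquare i j k) → T (inSquare i k k ∨ inSquare k j k)
      apex-vertex t = from T-∨ (Data.Sum.map₂ (λ t′ → T-∨-¬ʳ t′ ¬across) (to (T-∨ {inSquare i k k}) (inSquare-apex t)))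

      start-vertex : T (inSquare i j i) → T (inSquare i k i)
      start-vertex t = T-∨-¬ʳ (inSquare-start t) ¬across

      end-vertex : T (inSquare i j j) → T (inSquare k j j)
      end-vertex t = T-∨-¬ʳ (inSquare-end t) ¬across

  record Invariant (i j : ℕ) : Set where
    field
      ends-bound : bit (inSquare i j i) + (squaresInside i j + bit (inSquare i j j)) + 2 ≤ 2 * earsInside i j
      apex-bound : T (hasChordApex i j) → squaresInside i j + 4 ≤ 2 * earsInside i j
  open Invariant

  invariant-both : ∀ {i k j} → suc i < k → suc k < j → Edge i k → Edge k j →
                   Invariant i k → Invariant k j → Invariant i j
  invariant-both {i} {k} {j} 1+i<k 1+k<j ik kj L R =
    record { ends-bound = ends-from-interior (inSquare i j i) (inSquare i j j) interior ; apex-bound = λ _ → interior }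
    where
    open Fan (<-trans (n<1+n i) 1+i<k) (<-trans (n<1+n k) 1+k<j) ik kj
    interior : squaresInside i j + 4 ≤ 2 * earsInside i j
    interior = ≤-trans
      (both-sides-step (inSquare i k k) (inSquare k j k) (leftSquare i k j) (rightSquare i k j)
        squaresInside-split (bit-mono inSquare-apex)
        (budget-left {s = bit (inSquare i k i)} (inSquare i k k) (leftSquare i k j) (ends-bound L) (apex-bound L ∘ leftSquare⇒hasChordApex))
        (budget-right {s = bit (inSquare k j j)} (inSquare k j k) (rightSquare i k j) (ends-bound R) (apex-bound R ∘ rightSquare⇒hasChordApex)))
      (≤-trans (≤-reflexive (sym (*-distribˡ-+ 2 (earsInside i k) (earsInside k j)))) (*-monoʳ-≤ 2 earsInside-sides≤))

  invariant-left : ∀ {i k} → suc i < k → Edge i k → Edge k (suc k) → Invariant i k → Invariant i (suc k)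
  invariant-left {i} {k} 1+i<k ik kj L = record { ends-bound = ends ; apex-bound = ⊥-elim ∘ ¬hasChordApex-of-side (inj₂ (¬Chord-suc k)) }
    where
    open Fan (<-trans (n<1+n i) 1+i<k) (n<1+n k) ik kj
    open NoSquareAcross ¬squareAcross-right-side
    ends : bit (inSquare i (suc k) i) + (squaresInside i (suc k) + bit (inSquare i (suc k) (suc k))) + 2 ≤ 2 * earsInside i (suc k)
    ends = ≤-trans
      (left-side-ends squaresInside-split′ (count-empty (inSquare k (suc k)) (suc k))
         (bit-mono (λ t → T-∨-¬ʳ (apex-vertex t) ¬inSquare-side)) (bit-mono start-vertex)
         (bit-¬T (¬inSquare-side ∘ end-vertex)) (ends-bound L))
      (*-monoʳ-≤ 2 earsInside-left≤)

  invariant-right : ∀ {i j} → suc (suc i) < j → Edge i (suc i) → Edge (suc i) j → Invariant (suc i) j → Invariant i j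
  invariant-right {i} {j} 2+i<j ik kj R = record { ends-bound = ends ; apex-bound = ⊥-elim ∘ ¬hasChordApex-of-side (inj₁ (¬Chord-suc i)) }
    where
    open Fan (n<1+n i) (<-trans (n<1+n (suc i)) 2+i<j) ik kj
    open NoSquareAcross ¬squareAcross-left-side
    ends : bit (inSquare i j i) + (squaresInside i j + bit (inSquare i j j)) + 2 ≤ 2 * earsInside i j
    ends = ≤-trans
      (right-side-ends squaresInside-split′ (count-empty (inSquare i (suc i)) (suc i))
         (bit-mono (λ t → T-∨-¬ˡ (apex-vertex t) ¬inSquare-side)) (bit-¬T (¬inSquare-side ∘ start-vertex))
         (bit-mono end-vertex) (ends-bound R))
      (*-monoʳ-≤ 2 earsInside-right≤)

  invariant-triangle : ∀ {i} → Edge i (suc i) → Edge (suc i) (suc (suc i)) → Edge i (suc (suc i)) → Invariant i (suc (suc i))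
  invariant-triangle {i} ik kj ij =
    record { ends-bound = ends ; apex-bound = ⊥-elim ∘ ¬hasChordApex-of-side (inj₁ (¬Chord-suc i)) }
    where
    open Fan (n<1+n i) (n<1+n (suc i)) ik kj
    open NoSquareAcross ¬squareAcross-left-side
    ends : bit (inSquare i (suc (suc i)) i) + (squaresInside i (suc (suc i)) + bit (inSquare i (suc (suc i)) (suc (suc i)))) + 2
           ≤ 2 * earsInside i (suc (suc i))
    ends = leaf-ends squaresInside-split′ (count-empty (inSquare i (suc i)) (suc i))
             (bit-¬T (λ t → ¬T-∨ ¬inSquare-side ¬inSquare-side (apex-vertex t)))
             (count-empty (inSquare (suc i) (suc (suc i))) (suc (suc i)))
             (bit-¬T (¬inSquare-side ∘ start-vertex)) (bit-¬T (¬inSquare-side ∘ end-vertex))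
             (*-monoʳ-≤ 2 (≤-trans (≤-reflexive (sym (bit-T (ear-of-triangle ij)))) apex-ear≤))

  invariant : ∀ {i j} → suc i < j → j < n → Edge i j → Invariant i j
  invariant {i} {j} = go (j ∸ i) ≤-refl
    where
    go : ∀ size {i j} → j ∸ i ≤ size → suc i < j → j < n → Edge i j → Invariant i j
    go zero {i} {j} j∸i≤0 1+i<j _ _ = ⊥-elim (<⇒≱ (m<n⇒0<n∸m (<-trans (n<1+n i) 1+i<j)) j∸i≤0)
    go (suc size) {i} {j} j∸i≤ 1+i<j j<n ij with triangle-apex 1+i<j j<n ij
    ... | k , i<k , k<j , ik , kj with m≤n⇒m<n∨m≡n i<k | m≤n⇒m<n∨m≡n k<j
    ... | inj₁ 1+i<k | inj₁ 1+k<j = invariant-both 1+i<k 1+k<j ik kj (go size left-smaller 1+i<k (<-trans k<j j<n) ik)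
                                                                      (go size right-smaller 1+k<j j<n kj)
      where
      left-smaller = ≤-pred (≤-trans (∸-monoˡ-< k<j (<⇒≤ i<k)) j∸i≤)
      right-smaller = ≤-pred (≤-trans (∸-monoʳ-< i<k (<⇒≤ k<j)) j∸i≤)
    ... | inj₁ 1+i<k | inj₂ refl = invariant-left 1+i<k ik kj (go size (≤-pred (≤-trans (∸-monoˡ-< k<j (<⇒≤ i<k)) j∸i≤)) 1+i<k (<-trans k<j j<n) ik)
    ... | inj₂ refl | inj₁ 1+k<j = invariant-right 1+k<j ik kj (go size (≤-pred (≤-trans (∸-monoʳ-< i<k (<⇒≤ k<j)) j∸i≤)) 1+k<j j<n kj)
    ... | inj₂ refl | inj₂ refl = invariant-triangle ik kj ij

  module Root {j : ℕ} (1+j≡n : suc j ≡ n) where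

    private
      j≡last : j ≡ last
      j≡last = suc-injective (trans 1+j≡n (sym suc-last))
      j<n : j < n
      j<n = subst (j <_) 1+j≡n ≤-refl
      1<j : 1 < j
      1<j = ≤-pred (subst (3 ≤_) (sym 1+j≡n) 3≤n)
      0j : Edge 0 j
      0j = subst (Edge 0) (sym j≡last) closing-edge
      ¬0j : ¬ Chord 0 j
      ¬0j = ¬Chord-0-last ∘ subst (Chord 0) j≡last
      ≤j : ∀ {x y} → Chord x y → y ≤ j
      ≤j xy = ≤-pred (subst (_ <_) (sym 1+j≡n) (edge-bounded _ _ (Chord⇒Edge xy)))

    first-is-ear : Edge 1 j → T (chordless 0)
    first-is-ear 1j = chordless-intro no-chord
      where
      no-chord : ∀ y → ¬ Chord 0 y
      no-chord zero c = edge-irrefl 0 (Chord⇒Edge c)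
      no-chord (suc zero) c = ¬Chord-suc 0 c
      no-chord (suc (suc y)) c with m≤n⇒m<n∨m≡n (≤j c)
      ... | inj₂ refl = ¬0j c
      ... | inj₁ y<j = non-crossing (s≤s z≤n) (s≤s (s≤s z≤n)) y<j (Chord⇒Edge c) 1j

    last-is-ear : ∀ {k} → suc k ≡ j → Edge 0 k → T (chordless j)
    last-is-ear {k} refl 0k = chordless-intro no-chord
      where
      no-chord : ∀ y → ¬ Chord (suc k) y
      no-chord y c with m≤n⇒m<n∨m≡n (≤j c)
      ... | inj₂ refl = edge-irrefl y (Chord⇒Edge c)
      ... | inj₁ y<j with m≤n⇒m<n∨m≡n (≤-pred y<j)
      ...   | inj₂ refl = ¬Chord-suc y (Chord-sym c)
      ...   | inj₁ y<k with y
      ...     | zero = ¬0j (Chord-sym c)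
      ...     | suc _ = non-crossing (s≤s z≤n) y<k (n<1+n k) 0k (Chord⇒Edge (Chord-sym c))

    squaresOnRoot : ℕ
    squaresOnRoot = bit (inSquare 0 j 0) + (squaresInside 0 j + bit (inSquare 0 j j))

    RootBound : Set
    RootBound = squaresOnRoot + 4 ≤ 2 * (bit (chordless 0) + (earsInside 0 j + bit (chordless j)))

    root-both : ∀ {k} → 1 < k → suc k < j → Edge 0 k → Edge k j → RootBound
    root-both {k} 1<k 1+k<j 0k kj = ≤-trans
      (two-sides-ends {Sₗ = squaresInside 0 k} {Sᵣ = squaresInside k j} {aₗ = bit (inSquare 0 k k)} {aᵣ = bit (inSquare k j k)}
         squaresInside-split′ (≤-trans (bit-mono apex-vertex) (bit-∨ (inSquare 0 k k) (inSquare k j k))) (bit-mono start-vertex) (bit-mono end-vertex)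
         (ends-bound (invariant 1<k (<-trans k<j j<n) 0k)) (ends-bound (invariant 1+k<j j<n kj)))
      (≤-trans (≤-reflexive (sym (*-distribˡ-+ 2 (earsInside 0 k) (earsInside k j))))
               (*-monoʳ-≤ 2 (≤-trans earsInside-sides≤ (≤-trans (m≤m+n _ (bit (chordless j))) (m≤n+m _ (bit (chordless 0)))))))
      where
      k<j = <-trans (n<1+n k) 1+k<j
      open Fan (<-trans (n<1+n 0) 1<k) k<j 0k kj
      open NoSquareAcross (¬squareAcross-over-side ¬0j)

    root-left : ∀ {k} → 1 < k → suc k ≡ j → Edge 0 k → Edge k j → RootBound
    root-left {k} 1<k refl 0k kj =
      subst (λ c → squaresOnRoot + 4 ≤ 2 * (bit (chordless 0) + (earsInside 0 j + c))) (sym (bit-T (last-is-ear refl 0k)))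
        (plus-ear-at-end (earsInside 0 j) (bit (chordless 0))
          (left-side-ends squaresInside-split′ (count-empty (inSquare k j) j)
             (bit-mono (λ t → T-∨-¬ʳ (apex-vertex t) ¬inSquare-side)) (bit-mono start-vertex)
             (bit-¬T (¬inSquare-side ∘ end-vertex)) (ends-bound (invariant 1<k (<-trans (n<1+n k) j<n) 0k)))
          earsInside-left≤)
      where
      open Fan (<-trans (n<1+n 0) 1<k) (n<1+n k) 0k kj
      open NoSquareAcross (¬squareAcross-over-side ¬0j)

    root-right : 2 < j → Edge 0 1 → Edge 1 j → RootBound
    root-right 2<j e₀₁ 1j =
      subst (λ c → squaresOnRoot + 4 ≤ 2 * (c + (earsInside 0 j + bit (chordless j)))) (sym (bit-T (first-is-ear 1j)))
        (plus-ear-at-start (earsInside 0 j) (bit (chordless j))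
          (right-side-ends squaresInside-split′ (count-empty (inSquare 0 1) 1)
             (bit-mono (λ t → T-∨-¬ˡ (apex-vertex t) ¬inSquare-side)) (bit-¬T (¬inSquare-side ∘ start-vertex))
             (bit-mono end-vertex) (ends-bound (invariant 2<j j<n 1j)))
          earsInside-right≤)
      where
      open Fan (n<1+n 0) (<-trans (n<1+n 1) 2<j) e₀₁ 1j
      open NoSquareAcross (¬squareAcross-over-side ¬0j)

    root-triangle : 2 ≡ j → Edge 0 1 → Edge 1 2 → RootBound
    root-triangle refl e₀₁ e₁₂ =
      subst (λ c → squaresOnRoot + 4 ≤ 2 * (c + (earsInside 0 2 + bit (chordless 2)))) (sym (bit-T (first-is-ear e₁₂)))
        (plus-ear-at-start (earsInside 0 2) (bit (chordless 2))
          (leaf-ends squaresInside-split′ (count-empty (inSquare 0 1) 1)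
             (bit-¬T (λ t → ¬T-∨ ¬inSquare-side ¬inSquare-side (apex-vertex t)))
             (count-empty (inSquare 1 2) 2)
             (bit-¬T (¬inSquare-side ∘ start-vertex)) (bit-¬T (¬inSquare-side ∘ end-vertex))
             (*-monoʳ-≤ 2 (≤-trans (≤-reflexive (sym (bit-T (ear-of-triangle 0j)))) apex-ear≤)))
          ≤-refl)
      where
      open Fan (n<1+n 0) (n<1+n 1) e₀₁ e₁₂
      open NoSquareAcross (¬squareAcross-over-side ¬0j)

    root-bound : count (inSquare 0 j) 0 (suc j) + 4 ≤ 2 * count chordless 0 (suc j)
    root-bound rewrite count-ends (inSquare 0 j) (<-trans (n<1+n 0) 1<j) | count-ends chordless (<-trans (n<1+n 0) 1<j)
      with triangle-apex 1<j j<n 0j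
    ... | k , 0<k , k<j , 0k , kj with m≤n⇒m<n∨m≡n 0<k | m≤n⇒m<n∨m≡n k<j
    ... | inj₁ 1<k | inj₁ 1+k<j = root-both 1<k 1+k<j 0k kj
    ... | inj₁ 1<k | inj₂ 1+k≡j = root-left 1<k 1+k≡j 0k kj
    ... | inj₂ refl | inj₁ 2<j = root-right 2<j 0k kj
    ... | inj₂ refl | inj₂ 2≡j = root-triangle 2≡j 0k (subst (Edge 1) (sym 2≡j) kj)

  consecutive-cases : ∀ {x y} → T (consecutive x y) →
                      y ≡ suc x ⊎ x ≡ suc y ⊎ (x ≡ 0 × suc y ≡ n) ⊎ (y ≡ 0 × suc x ≡ n)
  consecutive-cases {x} {y} t with to (T-∨ {suc x ≡ᵇ y}) t
  ... | inj₁ e = inj₁ (sym (toWitness e))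
  ... | inj₂ t₁ with to (T-∨ {suc y ≡ᵇ x}) t₁
  ...   | inj₁ e = inj₂ (inj₁ (sym (toWitness e)))
  ...   | inj₂ t₂ with to (T-∨ {(x ≡ᵇ 0) ∧ (suc y ≡ᵇ n)}) t₂
  ...     | inj₁ e = let (x≡0 , 1+y≡n) = to (T-∧ {x ≡ᵇ 0}) e in inj₂ (inj₂ (inj₁ (toWitness x≡0 , toWitness 1+y≡n)))
  ...     | inj₂ e = let (y≡0 , 1+x≡n) = to (T-∧ {y ≡ᵇ 0}) e in inj₂ (inj₂ (inj₂ (toWitness y≡0 , toWitness 1+x≡n)))

  chordless-neighbour : ∀ {x y} → T (chordless x) → Edge x y → T (consecutive x y)
  chordless-neighbour {x} {y} ear xy with consecutive x y in c
  ... | true = tt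
  ... | false = chordless-elim ear (Edge⇒¬consecutive⇒Chord xy (λ t → subst T c t))

  chordless⇒degree-two : ∀ {x} → x < n → T (chordless x) → count (edge x) 0 n ≡ 2
  chordless⇒degree-two {zero} _ ear =
    count-two (edge 0) 1<last last<n (side-edge 0 (≤-trans (s≤s (s≤s z≤n)) 3≤n)) closing-edge others
    where
    others : ∀ y → y < n → y ≢ 1 → y ≢ last → ¬ Edge 0 y
    others y _ y≢1 y≢last e with consecutive-cases (chordless-neighbour ear e)
    ... | inj₁ y≡1 = y≢1 y≡1
    ... | inj₂ (inj₁ ())
    ... | inj₂ (inj₂ (inj₁ (_ , 1+y≡n))) = y≢last (suc-injective (trans 1+y≡n (sym suc-last)))
    ... | inj₂ (inj₂ (inj₂ (refl , _))) = edge-irrefl 0 e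
  chordless⇒degree-two {suc x} 1+x<n ear with m≤n⇒m<n∨m≡n (≤-pred (subst (suc x <_) (sym suc-last) 1+x<n))
  ... | inj₁ 1+x<last =
    count-two (edge (suc x)) (<-trans (n<1+n x) (n<1+n (suc x))) 2+x<n (Edge-sym (side-edge x 1+x<n)) (side-edge (suc x) 2+x<n) others
    where
    2+x<n : suc (suc x) < n
    2+x<n = subst (suc (suc x) <_) suc-last (s≤s 1+x<last)
    others : ∀ y → y < n → y ≢ x → y ≢ suc (suc x) → ¬ Edge (suc x) y
    others y _ y≢x y≢2+x e with consecutive-cases (chordless-neighbour ear e)
    ... | inj₁ y≡2+x = y≢2+x y≡2+x
    ... | inj₂ (inj₁ 1+x≡1+y) = y≢x (sym (suc-injective 1+x≡1+y))
    ... | inj₂ (inj₂ (inj₁ (() , _)))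
    ... | inj₂ (inj₂ (inj₂ (_ , 2+x≡n))) = <-irrefl 2+x≡n 2+x<n
  ... | inj₂ 1+x≡last =
    subst (λ z → count (edge z) 0 n ≡ 2) (sym 1+x≡last)
      (count-two (edge last) 0<x (<-trans (n<1+n x) 1+x<n) (Edge-sym closing-edge) (subst (λ z → Edge z x) 1+x≡last (Edge-sym (side-edge x 1+x<n))) others)
    where
    0<x : 0 < x
    0<x = ≤-pred (subst (1 <_) (sym 1+x≡last) 1<last)
    others : ∀ y → y < n → y ≢ 0 → y ≢ x → ¬ Edge last y
    others y y<n y≢0 y≢x e with consecutive-cases (chordless-neighbour (subst (T ∘ chordless) 1+x≡last ear) e)
    ... | inj₁ y≡1+last = <-irrefl (trans y≡1+last suc-last) y<n
    ... | inj₂ (inj₁ last≡1+y) = y≢x (suc-injective (trans (sym last≡1+y) (sym 1+x≡last)))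
    ... | inj₂ (inj₂ (inj₁ (last≡0 , _))) = <-irrefl (sym last≡0) (<-trans (s≤s z≤n) 1<last)
    ... | inj₂ (inj₂ (inj₂ (y≡0 , _))) = y≢0 y≡0

  squares-vs-ears : count (inSquare 0 last) 0 n + 4 ≤ 2 * count chordless 0 n
  squares-vs-ears = subst (λ m → count (inSquare 0 last) 0 m + 4 ≤ 2 * count chordless 0 m) suc-last (Root.root-bound suc-last)

  ears-have-degree-two : count chordless 0 n ≤ count (λ x → count (edge x) 0 n ≡ᵇ 2) 0 n
  ears-have-degree-two = count-mono chordless _ 0 n
    (λ x _ x<n ear → subst (λ d → T (d ≡ᵇ 2)) (sym (chordless⇒degree-two x<n ear)) (fromWitness {a? = 2 Data.Nat.≟ 2} refl))

module Drawing {n : ℕ} (3≤n : 3 ≤ n) (G : Graph n) (maximal : MaximalOuterplanar G)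
               (pos : Fin n → Fin n) (pos-injective : Injective _≡_ _≡_ pos) (drawn : NonCrossing pos (adj G)) where

  vertexAt : Fin n → Fin n
  vertexAt t = proj₁ (injective⇒surjective pos pos-injective t)

  pos-vertexAt : ∀ t → pos (vertexAt t) ≡ t
  pos-vertexAt t = proj₂ (injective⇒surjective pos pos-injective t)

  vertexAt-pos : ∀ v → vertexAt (pos v) ≡ v
  vertexAt-pos v = pos-injective (pos-vertexAt (pos v))

  place : ∀ {a} → a < n → Fin n
  place a<n = vertexAt (fromℕ< a<n)

  position-place : ∀ {a} (a<n : a < n) → toℕ (pos (place a<n)) ≡ a
  position-place a<n = trans (cong toℕ (pos-vertexAt _)) (toℕ-fromℕ< a<n)

  edgeAt : ℕ → ℕ → Bool
  edgeAt a b with a <? n | b <? n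
  ... | yes a<n | yes b<n = adj G (place a<n) (place b<n)
  ... | _       | _       = false

  edgeAt-place : ∀ {a b} (a<n : a < n) (b<n : b < n) → edgeAt a b ≡ adj G (place a<n) (place b<n)
  edgeAt-place {a} {b} a<n b<n with a <? n | b <? n
  ... | yes _ | yes _ = refl
  ... | no a≮n | _ = ⊥-elim (a≮n a<n)
  ... | yes _ | no b≮n = ⊥-elim (b≮n b<n)

  edgeAt-placed : ∀ {a b} → T (edgeAt a b) → Σ (a < n) λ a<n → Σ (b < n) λ b<n → T (adj G (place a<n) (place b<n))
  edgeAt-placed {a} {b} t with a <? n | b <? n
  ... | yes a<n | yes b<n = a<n , b<n , t

  edgeAt-toℕ : ∀ s t → edgeAt (toℕ s) (toℕ t) ≡ adj G (vertexAt s) (vertexAt t)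
  edgeAt-toℕ s t = trans (edgeAt-place (toℕ<n s) (toℕ<n t))
                         (cong₂ (λ s′ t′ → adj G (vertexAt s′) (vertexAt t′)) (fromℕ<-toℕ s _) (fromℕ<-toℕ t _))

  edgeAt-pos : ∀ u v → edgeAt (toℕ (pos u)) (toℕ (pos v)) ≡ adj G u v
  edgeAt-pos u v = trans (edgeAt-toℕ (pos u) (pos v)) (cong₂ (adj G) (vertexAt-pos u) (vertexAt-pos v))

  edgeAt-sym : ∀ a b → edgeAt a b ≡ edgeAt b a
  edgeAt-sym a b with a <? n | b <? n
  ... | yes a<n | yes b<n = Graph.sym G (place a<n) (place b<n)
  ... | yes _   | no _    = refl
  ... | no _    | yes _   = refl
  ... | no _    | no _    = refl

  edgeAt-irrefl : ∀ a → ¬ T (edgeAt a a)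
  edgeAt-irrefl a t with edgeAt-placed t
  ... | a<n , _ , t′ = subst T (Graph.irrefl G (place a<n)) t′

  ordered⇒Cross : ∀ {u v x y} → toℕ (pos u) < toℕ (pos x) → toℕ (pos x) < toℕ (pos v) → toℕ (pos v) < toℕ (pos y) →
                  Cross pos u v x y
  ordered⇒Cross u<x x<v v<y =
    (λ e → <-irrefl (cong toℕ (sym e)) u<x) , (λ e → <-irrefl (cong toℕ e) x<v) ,
    (λ e → <-irrefl (cong toℕ (sym e)) u<y) , (λ e → <-irrefl (cong toℕ (sym e)) v<y) ,
    inj₁ (inj₁ (u<x , x<v) , [ (λ (_ , y<v) → <-asym y<v v<y) , (λ (_ , y<u) → <-asym y<u u<y) ]′)
    where
    u<y = <-trans u<x (<-trans x<v v<y)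

  edgeAt-non-crossing : ∀ {a c b d} → a < c → c < b → b < d → T (edgeAt a b) → T (edgeAt c d) → ⊥
  edgeAt-non-crossing a<c c<b b<d ab cd with edgeAt-placed ab | edgeAt-placed cd
  ... | a<n , b<n , uv | c<n , d<n , xy =
    drawn (place a<n) (place b<n) (place c<n) (place d<n) uv xy
      (ordered⇒Cross (at a<n c<n a<c) (at c<n b<n c<b) (at b<n d<n b<d))
    where
    at : ∀ {p q} (p<n : p < n) (q<n : q < n) → p < q → toℕ (pos (place p<n)) < toℕ (pos (place q<n))
    at p<n q<n = subst₂ _<_ (sym (position-place p<n)) (sym (position-place q<n))

  edgeAt-saturated : ∀ {a b} → a < b → b < n → ¬ T (edgeAt a b) →
                     ¬ (∀ {c d} → a < c → c < b → d < n → d < a ⊎ b < d → ¬ T (edgeAt c d))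
  edgeAt-saturated {a} {b} a<b b<n ¬ab unseparated =
    proj₂ maximal u v u≢v (¬T⇒≡false (¬ab ∘ subst T (sym (edgeAt-place a<n b<n))))
      (pos , pos-injective , addEdge-noncrossing u v drawn new-old old-new)
    where
    a<n = <-trans a<b b<n
    u = place a<n
    v = place b<n
    U≡a : toℕ (pos u) ≡ a
    U≡a = position-place a<n
    V≡b : toℕ (pos v) ≡ b
    V≡b = position-place b<n
    U<V : toℕ (pos u) < toℕ (pos v)
    U<V = subst₂ _<_ (sym U≡a) (sym V≡b) a<b
    u≢v : u ≢ v
    u≢v u≡v = <-irrefl (cong (toℕ ∘ pos) u≡v) U<V
    toℕ-≢ : ∀ {s t : Fin n} → s ≢ t → toℕ s ≢ toℕ t
    toℕ-≢ s≢t = s≢t ∘ toℕ-injective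
    edge-between : ∀ {x y c d} → T (adj G x y) → IsPair (toℕ (pos x)) (toℕ (pos y)) c d → T (edgeAt c d)
    edge-between {x} {y} xy (inj₁ (refl , refl)) = subst T (sym (edgeAt-pos x y)) xy
    edge-between {x} {y} xy (inj₂ (refl , refl)) = subst T (edgeAt-sym (toℕ (pos x)) (toℕ (pos y))) (subst T (sym (edgeAt-pos x y)) xy)
    endpoint<n : ∀ {x y c d} → IsPair (toℕ (pos x)) (toℕ (pos y)) c d → d < n
    endpoint<n {y = y} (inj₁ (_ , refl)) = toℕ<n (pos y)
    endpoint<n {x = x} (inj₂ (_ , refl)) = toℕ<n (pos x)
    separated : ∀ {x y c d} → T (adj G x y) → IsPair (toℕ (pos x)) (toℕ (pos y)) c d →
                toℕ (pos u) < c → c < toℕ (pos v) → Outside (toℕ (pos u)) (toℕ (pos v)) d → ⊥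
    separated {c = c} {d} xy ends u<c c<v out =
      unseparated (subst (_< c) U≡a u<c) (subst (c <_) V≡b c<v) (endpoint<n ends)
        ([ inj₁ ∘ subst (d <_) U≡a , inj₂ ∘ subst (_< d) V≡b ]′ out) (edge-between xy ends)
    new-old : ∀ x y → T (adj G x y) → ¬ Cross pos u v x y
    new-old x y xy (x≢u , x≢v , y≢u , y≢v , one)
      with one-inside-one-outside U<V (toℕ-≢ x≢u) (toℕ-≢ x≢v) (toℕ-≢ y≢u) (toℕ-≢ y≢v) one
    ... | _ , _ , u<c , c<v , out , ends = separated xy ends u<c c<v out
    old-new : ∀ x y → T (adj G x y) → ¬ Cross pos x y u v
    old-new x y xy (u≢x , u≢y , v≢x , v≢y , one)
      with one-inside-one-outside U<V (toℕ-≢ (≢-sym u≢x)) (toℕ-≢ (≢-sym v≢x)) (toℕ-≢ (≢-sym u≢y)) (toℕ-≢ (≢-sym v≢y))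
             (exactlyOneInside-swap U<V (toℕ-≢ (≢-sym u≢x)) (toℕ-≢ (≢-sym v≢x)) (toℕ-≢ (≢-sym u≢y)) (toℕ-≢ (≢-sym v≢y)) one)
    ... | _ , _ , u<c , c<v , out , ends = separated xy ends u<c c<v out

  convex : ConvexMaximalOuterplanar n
  convex = record
    { 3≤n = 3≤n ; edge = edgeAt ; edge-sym = edgeAt-sym ; edge-bounded = λ _ _ t → proj₁ (proj₂ (edgeAt-placed t))
    ; edge-irrefl = edgeAt-irrefl ; non-crossing = edgeAt-non-crossing ; saturated = edgeAt-saturated }

  open Convex convex public

  chordAdj⇒Chord : ∀ {x y} → T (chordAdj G pos x y) → Chord (toℕ (pos x)) (toℕ (pos y))
  chordAdj⇒Chord {x} {y} = subst (λ e → T (e ∧ not (OuterPair pos x y))) (sym (edgeAt-pos x y))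

  onChord4Cycle⇒inSquare : ∀ v → T (OnChord4Cycle G pos v) → T (inSquare 0 last (toℕ (pos v)))
  onChord4Cycle⇒inSquare v t
    with anyV-sound _ t
  ... | a , t₁ with anyV-sound _ t₁
  ... | b , t₂ with anyV-sound _ t₂
  ... | c , t₃ =
    let (v≢a , t₄) = to (T-∧ {neq v a}) t₃
        (v≢b , t₅) = to (T-∧ {neq v b}) t₄
        (v≢c , t₆) = to (T-∧ {neq v c}) t₅
        (a≢b , t₇) = to (T-∧ {neq a b}) t₆
        (a≢c , t₈) = to (T-∧ {neq a c}) t₇
        (b≢c , t₉) = to (T-∧ {neq b c}) t₈
        (va , t₁₀) = to (T-∧ {chordAdj G pos v a}) t₉
        (ab , t₁₁) = to (T-∧ {chordAdj G pos a b}) t₁₀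
        (bc , cv) = to (T-∧ {chordAdj G pos b c}) t₁₁
    in inSquare-complete (toℕ (pos a) , toℕ (pos b) , toℕ (pos c) ,
         record { ab = chordAdj⇒Chord va ; bc = chordAdj⇒Chord ab ; cd = chordAdj⇒Chord bc ; da = chordAdj⇒Chord cv
                ; a≢b = apart v≢a ; a≢c = apart v≢b ; a≢d = apart v≢c ; b≢c = apart a≢b ; b≢d = apart a≢c ; c≢d = apart b≢c } ,
         within v , within a , within b , within c)
    where
    apart : ∀ {x y} → T (neq x y) → toℕ (pos x) ≢ toℕ (pos y)
    apart x≢y = toWitnessFalse x≢y ∘ pos-injective ∘ toℕ-injective
    within : ∀ w → Within 0 last (toℕ (pos w))
    within w = z≤n , ≤-pred (subst (toℕ (pos w) <_) (sym suc-last) (toℕ<n (pos w)))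

  sizeA≤squares : sizeA G pos ≤ count (inSquare 0 last) 0 n
  sizeA≤squares = begin
      countV (OnChord4Cycle G pos)
    ≤⟨ countV-mono _ _ onChord4Cycle⇒inSquare ⟩
      countV (onSquare ∘ pos)
    ≡⟨ countV-permute pos pos-injective onSquare ⟩
      countV onSquare
    ≡⟨ countV-as-count onSquare (inSquare 0 last) (λ _ → refl) ⟩
      count (inSquare 0 last) 0 n ∎
    where
    open ≤-Reasoning
    onSquare : Fin n → Bool
    onSquare t = inSquare 0 last (toℕ t)

  degree-as-count : ∀ v → degree G v ≡ count (edgeAt (toℕ (pos v))) 0 n
  degree-as-count v = begin
      countV (adj G v)
    ≡⟨ countV-cong _ _ (λ w → cong (adj G v) (sym (vertexAt-pos w))) ⟩
      countV (neighbourAt ∘ pos)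
    ≡⟨ countV-permute pos pos-injective neighbourAt ⟩
      countV neighbourAt
    ≡⟨ countV-as-count neighbourAt (edgeAt (toℕ (pos v))) (λ t → trans (edgeAt-toℕ (pos v) t) (cong (λ u → adj G u (vertexAt t)) (vertexAt-pos v))) ⟩
      count (edgeAt (toℕ (pos v))) 0 n ∎
    where
    open ≡-Reasoning
    neighbourAt : Fin n → Bool
    neighbourAt t = adj G v (vertexAt t)

  sizeB2≡degree-two : sizeB2 G ≡ count (λ x → count (edgeAt x) 0 n ≡ᵇ 2) 0 n
  sizeB2≡degree-two = begin
      countV (λ v → degree G v ≡ᵇ 2)
    ≡⟨ countV-cong _ _ (λ v → cong (_≡ᵇ 2) (degree-as-count v)) ⟩
      countV (degreeTwoAt ∘ pos)
    ≡⟨ countV-permute pos pos-injective degreeTwoAt ⟩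
      countV degreeTwoAt
    ≡⟨ countV-as-count degreeTwoAt _ (λ _ → refl) ⟩
      count (λ x → count (edgeAt x) 0 n ≡ᵇ 2) 0 n ∎
    where
    open ≡-Reasoning
    degreeTwoAt : Fin n → Bool
    degreeTwoAt t = count (edgeAt (toℕ t)) 0 n ≡ᵇ 2

lemma5p2 : (n : ℕ) → 3 ≤ n → (G : Graph n) → MaximalOuterplanar G →
    (pos : Fin n → Fin n) → OuterplaneEmbedding (adj G) pos →
    sizeA G pos + 4 ≤ 2 * sizeB2 G
lemma5p2 n 3≤n G maximal pos (pos-injective , drawn) = begin
    sizeA G pos + 4
  ≤⟨ +-monoˡ-≤ 4 sizeA≤squares ⟩
    count (inSquare 0 last) 0 n + 4
  ≤⟨ squares-vs-ears ⟩
    2 * count chordless 0 n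
  ≤⟨ *-monoʳ-≤ 2 ears-have-degree-two ⟩
    2 * count (λ x → count (edgeAt x) 0 n ≡ᵇ 2) 0 n
  ≡⟨ cong (2 *_) (sym sizeB2≡degree-two) ⟩
    2 * sizeB2 G ∎
  where
  open ≤-Reasoning
  open Drawing 3≤n G maximal pos pos-injective drawn
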